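{- Let $M$ be a simple binary matroid with $r(M)=4$ and $|E(M)|>9$. Then either $M$ has an induced restriction isomorphic to $M(C_4)$ or to $M(K_4)$, or $M$ has no induced minor isomorphic to $M(K_4)$.
   Context: All matroids are simple; every contraction is immediately followed by simplification. An induced restriction of $M$ is $M|F$ for a flat $F$ of $M$; an induced minor is any matroid obtained by a sequence of contractions (followed by simplification) and restrictions to flats. $M(C_4)\cong U_{3,4}$. -}

module Defs where

open import Data.Bool using (Bool; true; false; not; _xor_; T; if_then_else_)
open import Data.Nat using (ℕ; zero; suc; _≤_)
open import Data.Fin using (Fin; zero; suc)
open import Data.Fin.Subset using (Subset; _∈_; ∣_∣)
open import Data.Vec using (Vec; []; _∷_; replicate; zipWith)
open import Data.Product using (Σ; Σ-syntax; _×_; _,_)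
open import Data.Sum using (_⊎_)
open import Relation.Nullary using (¬_)
open import Relation.Unary using (Pred)
open import Relation.Binary.PropositionalEquality using (_≡_; _≢_)
open import Function.Bundles using (_↔_; _⇔_; Inverse)
open import Level using (0ℓ)

-- Abstract matroids, given by a ground set and an independence predicate.
-- (Only finite matroids arise below; axioms are not needed as fields since
-- every matroid considered is built from a binary column matroid.)

record Matroid : Set₁ where
  field
    E   : Set
    Ind : Pred E 0ℓ → Set
open Matroid public

-- finite subsets are given as Bool-valued characteristic functions
⟦_⟧ : {A : Set} → (A → Bool) → Pred A 0ℓ
⟦ S ⟧ x = T (S x)

｛_｝ : {A : Set} → A → Pred A 0ℓ
｛ e ｝ x = x ≡ e

pair : {A : Set} → A → A → Pred A 0ℓ
pair e f x = x ≡ e ⊎ x ≡ f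

_∪_ : {A : Set} → Pred A 0ℓ → Pred A 0ℓ → Pred A 0ℓ
(P ∪ Q) x = P x ⊎ Q x

_⊆_ : {A : Set} → Pred A 0ℓ → Pred A 0ℓ → Set
P ⊆ Q = ∀ x → P x → Q x

-- Simple: no loops and no parallel pairs, i.e. every set of size ≤ 2 is
-- independent.

Simple : Matroid → Set
Simple M = ∀ e f → Ind M (pair e f)

-- Closure / flats.  e ∈ cl(F) iff e ∈ F or some independent I ⊆ F has
-- I ∪ {e} dependent.  F is a flat iff cl(F) ⊆ F.

Flat : (M : Matroid) → (E M → Bool) → Set
Flat M F = ∀ e →
  (Σ[ I ∈ (E M → Bool) ] (⟦ I ⟧ ⊆ ⟦ F ⟧) × Ind M ⟦ I ⟧ × ¬ Ind M (⟦ I ⟧ ∪ ｛ e ｝))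
  → T (F e)

lift : {A : Set} (S : A → Bool) → Pred (Σ A (λ a → T (S a))) 0ℓ → Pred A 0ℓ
lift S I a = Σ (T (S a)) (λ s → I (a , s))

_∣_ : (M : Matroid) → (E M → Bool) → Matroid
M ∣ S = record { E = Σ (E M) (λ e → T (S e)) ; Ind = λ I → Ind M (lift S I) }

IsBasisOf : (M : Matroid) → (E M → Bool) → (E M → Bool) → Set
IsBasisOf M C B = (⟦ B ⟧ ⊆ ⟦ C ⟧) × Ind M ⟦ B ⟧ ×
  (∀ e → T (C e) → ¬ T (B e) → ¬ Ind M (⟦ B ⟧ ∪ ｛ e ｝))

_／_ : (M : Matroid) → (E M → Bool) → Matroid
M ／ C = record
  { E   = Σ (E M) (λ e → T (not (C e)))
  ; Ind = λ I → Σ[ B ∈ (E M → Bool) ] IsBasisOf M C B × Ind M (lift (λ e → not (C e)) I ∪ ⟦ B ⟧)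
  }

-- Simplification: si(K) = K|S where S contains no loops, no two parallel
-- elements, and meets every parallel class of non-loops.

IsSimplificationSet : (K : Matroid) → (E K → Bool) → Set
IsSimplificationSet K S =
  (∀ e f → T (S e) → T (S f) → Ind K (pair e f)) ×
  (∀ e → Ind K ｛ e ｝ → Σ[ f ∈ E K ] T (S f) × (f ≡ e ⊎ ¬ Ind K (pair e f)))

_≅_ : Matroid → Matroid → Set₁
N ≅ M = Σ[ φ ∈ (E N ↔ E M) ]
  (∀ (I : Pred (E N) 0ℓ) → Ind N I ⇔ Ind M (λ y → I (Inverse.from φ y)))

data _≼_ (N : Matroid) : Matroid → Set₁ where
  done  : ∀ {M} → N ≅ M → N ≼ M
  restr : ∀ {M} (F : E M → Bool) → Flat M F → N ≼ (M ∣ F) → N ≼ M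
  contr : ∀ {M} (C : E M → Bool) (S : E (M ／ C) → Bool) →
          IsSimplificationSet (M ／ C) S → N ≼ ((M ／ C) ∣ S) → N ≼ M

0v : ∀ {n} → Vec Bool n
0v = replicate _ false

_+v_ : ∀ {n} → Vec Bool n → Vec Bool n → Vec Bool n
_+v_ = zipWith _xor_

sumOver : ∀ {m n} → (Fin m → Bool) → (Fin m → Vec Bool n) → Vec Bool n
sumOver {zero}  J f = 0v
sumOver {suc m} J f =
  (if J zero then f zero else 0v) +v sumOver (λ x → J (suc x)) (λ x → f (suc x))

colMat : ∀ {n m} → (Fin m → Vec Bool n) → Matroid
colMat {n} {m} A = record
  { E   = Fin m
  ; Ind = λ I → ∀ (J : Fin m → Bool) → ⟦ J ⟧ ⊆ I → Σ (Fin m) (λ x → T (J x)) →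
                sumOver J A ≢ 0v
  }

HasRank : ∀ {n m} → (Fin m → Vec Bool n) → ℕ → Set
HasRank {n} {m} A k =
  (Σ[ S ∈ Subset m ] ∣ S ∣ ≡ k × Ind (colMat A) (_∈ S)) ×
  (∀ (S : Subset m) → Ind (colMat A) (_∈ S) → ∣ S ∣ ≤ k)

-- Graphic matroids of K4 and C4 via the GF(2) vertex–edge incidence matrix.

v : Bool → Bool → Bool → Bool → Vec Bool 4
v a b c d = a ∷ b ∷ c ∷ d ∷ []

incK4 : Fin 6 → Vec Bool 4
incK4 zero = v true true false false
incK4 (suc zero) = v true false true false
incK4 (suc (suc zero)) = v true false false true
incK4 (suc (suc (suc zero))) = v false true true false
incK4 (suc (suc (suc (suc zero)))) = v false true false true
incK4 (suc (suc (suc (suc (suc zero))))) = v false false true true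

incC4 : Fin 4 → Vec Bool 4
incC4 zero = v true true false false
incC4 (suc zero) = v false true true false
incC4 (suc (suc zero)) = v false false true true
incC4 (suc (suc (suc zero))) = v true false false true

MK4 : Matroid
MK4 = colMat incK4

MC4 : Matroid
MC4 = colMat incC4

-- A simple binary matroid of rank 4 is a set M of points of PG(3,2), the nonzero vectors of GF(2)^4.
-- An induced minor isomorphic to M(K4) has rank 3, and every step of a derivation either keeps the
-- matroid up to isomorphism or lowers its rank; so M(K4) can only arise as M restricted to a plane
-- meeting M in exactly six points, or as the simplification of M/p for a point p of M lying on exactly
-- six lines that meet M again. A plane meeting M in six points, or in four points no three collinear,
-- is itself an induced restriction isomorphic to M(K4) or M(C4). That every set of at least ten points
-- has such a plane or avoids both six-configurations is checked over all 2^15 sets of points.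

module Submission where

open import Defs
open import Data.Bool using (Bool)
open import Data.Nat using (ℕ; _<_)
open import Data.Fin using (Fin)
open import Data.Vec using (Vec)
open import Data.Product using (Σ-syntax; _×_)
open import Data.Sum using (_⊎_)
open import Relation.Nullary using (¬_)

open import Algebra.Bundles using (CommutativeRing)
open import Data.Bool using (true; false; not; _∧_; _∨_; _xor_; T; if_then_else_)
open import Data.Bool.Properties
  using (xor-comm; xor-assoc; xor-same; xor-identityʳ; ∧-identityʳ; xor-∧-commutativeRing; ∧-distribˡ-xor; T-irrelevant; T-≡; T-not-≡)
import Data.Bool.Properties as Bool
open import Algebra.Properties.CommutativeSemigroup (CommutativeRing.+-commutativeSemigroup xor-∧-commutativeRing)
  using () renaming (interchange to xor-interchange)
open import Data.Empty using (⊥; ⊥-elim)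
open import Data.Fin using (zero; suc; _↑ˡ_)
open import Data.Fin.Properties using (_≟_; 0≢1+n; suc-injective; any?; injective⇒≤; +↔⊎; ↑ˡ-injective)
open import Data.Fin.Subset using (Subset; _∈_; ∣_∣)
open import Data.Nat using (zero; suc; _+_; _≤_; s≤s; _≡ᵇ_; _<ᵇ_)
open import Data.Nat.Properties using (≤-antisym; ≤-trans; ≤-pred; n≮n; <⇒≱; m≤m+n; <ᵇ⇒<; ≡⇒≡ᵇ)
open import Data.Product using (Σ; ∃; ∃₂; _,_; proj₁; proj₂)
open import Data.Sum using (inj₁; inj₂; [_,_]′)
import Data.Sum
open import Data.Sum.Function.Propositional using (_⊎-↔_)
open import Data.Unit using (tt)
open import Data.Vec using ([]; _∷_; lookup; tabulate)
open import Data.Vec.Functional using () renaming (_∷_ to _∷ᶠ_; [] to []ᶠ)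
open import Data.Vec.Properties
  using (≡-dec; lookup∘tabulate; lookup-zipWith; lookup-replicate; zipWith-comm; zipWith-assoc;
         zipWith-identityˡ; zipWith-identityʳ; []=⇒lookup; lookup⇒[]=)
open import Function.Bundles using (_↔_; _↣_; _⇔_; Inverse; Injection; Equivalence; mk↔ₛ′; mk⇔; mk↣)
open import Function.Construct.Composition using (_↣-∘_; _↔-∘_)
open import Function.Definitions using (Injective)
open import Function.Properties.Inverse using (↔-sym; ↔-refl; ↔⇒↣)
open import Level using (0ℓ)
open import Relation.Binary.Definitions using (DecidableEquality)
open import Relation.Binary.PropositionalEquality
open import Relation.Nullary using (Dec; yes; no; does)
open import Relation.Nullary.Decidable using (T?; _×-dec_; map′; ¬¬-excluded-middle; decidable-stable)
open import Relation.Unary using (Pred)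

true≢false : true ≢ false
true≢false ()

T-∧ˡ : ∀ {a b} → T (a ∧ b) → T a
T-∧ˡ {true} _ = tt

T-∧ʳ : ∀ {a b} → T (a ∧ b) → T b
T-∧ʳ {true} t = t

T-∧-intro : ∀ {a b} → T a → T b → T (a ∧ b)
T-∧-intro {true} _ t = t

T-∨-introˡ : ∀ {a b} → T a → T (a ∨ b)
T-∨-introˡ {true} _ = tt

T-∨-introʳ : ∀ {a b} → T b → T (a ∨ b)
T-∨-introʳ {true}  _ = tt
T-∨-introʳ {false} t = t

T-∨-split : ∀ {a b} → T (a ∨ b) → T a ⊎ T b
T-∨-split {true}  t = inj₁ t
T-∨-split {false} t = inj₂ t

T-not-intro : ∀ {b} → ¬ T b → T (not b)
T-not-intro {true}  ¬t = ¬t tt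
T-not-intro {false} _  = tt

T-not-elim : ∀ {b} → T (not b) → T b → ⊥
T-not-elim {true} () _

∧≡true : ∀ {a b} → (a ∧ b) ≡ true → a ≡ true × b ≡ true
∧≡true {true} e = refl , e

-- Vectors over GF(2)

V : ℕ → Set
V = Vec Bool

+v-comm : ∀ {n} (x y : V n) → x +v y ≡ y +v x
+v-comm = zipWith-comm xor-comm

+v-assoc : ∀ {n} (x y z : V n) → (x +v y) +v z ≡ x +v (y +v z)
+v-assoc = zipWith-assoc xor-assoc

+v-identityˡ : ∀ {n} (x : V n) → 0v +v x ≡ x
+v-identityˡ = zipWith-identityˡ (λ _ → refl)

+v-identityʳ : ∀ {n} (x : V n) → x +v 0v ≡ x
+v-identityʳ = zipWith-identityʳ xor-identityʳ

+v-same : ∀ {n} (x : V n) → x +v x ≡ 0v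
+v-same []      = refl
+v-same (a ∷ x) = cong₂ _∷_ (xor-same a) (+v-same x)

+v-involutive : ∀ {n} (x p : V n) → (x +v p) +v p ≡ x
+v-involutive x p = trans (+v-assoc x p p) (trans (cong (x +v_) (+v-same p)) (+v-identityʳ x))

+v-cancelʳ : ∀ {n} {x y : V n} (p : V n) → x +v p ≡ y +v p → x ≡ y
+v-cancelʳ {x = x} {y} p e = begin
  x               ≡⟨ sym (+v-involutive x p) ⟩
  (x +v p) +v p   ≡⟨ cong (_+v p) e ⟩
  (y +v p) +v p   ≡⟨ +v-involutive y p ⟩
  y               ∎
  where open ≡-Reasoning

+v≡0⇒≡ : ∀ {n} {x y : V n} → x +v y ≡ 0v → x ≡ y
+v≡0⇒≡ {y = y} e = +v-cancelʳ y (trans e (sym (+v-same y)))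

+v-swap : ∀ {n} {x y z : V n} → x ≡ y +v z → x +v y ≡ z
+v-swap {x = x} {y} {z} refl = trans (cong (_+v y) (+v-comm y z)) (+v-involutive z y)

+v-interchange : ∀ {n} (a b c d : V n) → (a +v b) +v (c +v d) ≡ (a +v c) +v (b +v d)
+v-interchange a b c d = begin
  (a +v b) +v (c +v d)   ≡⟨ +v-assoc a b (c +v d) ⟩
  a +v (b +v (c +v d))   ≡⟨ cong (a +v_) (sym (+v-assoc b c d)) ⟩
  a +v ((b +v c) +v d)   ≡⟨ cong (λ u → a +v (u +v d)) (+v-comm b c) ⟩
  a +v ((c +v b) +v d)   ≡⟨ cong (a +v_) (+v-assoc c b d) ⟩
  a +v (c +v (b +v d))   ≡⟨ sym (+v-assoc a c (b +v d)) ⟩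
  (a +v c) +v (b +v d)   ∎
  where open ≡-Reasoning

infix 4 _≟ᵛ_ _==_

_≟ᵛ_ : ∀ {n} → DecidableEquality (V n)
_≟ᵛ_ = ≡-dec Bool._≟_

_==_ : ∀ {n} → V n → V n → Bool
[]      == []      = true
(a ∷ u) == (b ∷ v) = (if a then b else not b) ∧ (u == v)

isZero : ∀ {n} → V n → Bool
isZero v = v == 0v

==-sound : ∀ {n} {u v : V n} → T (u == v) → u ≡ v
==-sound {u = []}        {[]}        _ = refl
==-sound {u = true ∷ u}  {true ∷ v}  t = cong (true ∷_) (==-sound t)
==-sound {u = false ∷ u} {false ∷ v} t = cong (false ∷_) (==-sound t)

==-refl : ∀ {n} (u : V n) → T (u == u)
==-refl []          = tt
==-refl (true ∷ u)  = ==-refl u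
==-refl (false ∷ u) = ==-refl u

==-complete : ∀ {n} {u v : V n} → u ≡ v → T (u == v)
==-complete {u = u} refl = ==-refl u

≠-sound : ∀ {n} {u v : V n} → T (not (u == v)) → u ≢ v
≠-sound {u = u} t refl with u == u | ==-refl u
... | true | _ = t

scale : ∀ {n} → Bool → V n → V n
scale b x = if b then x else 0v

scale-xor : ∀ {n} (a b : Bool) (x : V n) → scale (a xor b) x ≡ scale a x +v scale b x
scale-xor true  true  x = sym (+v-same x)
scale-xor true  false x = sym (+v-identityʳ x)
scale-xor false b     x = sym (+v-identityˡ (scale b x))

sumOver-cong : ∀ {m n} {J J′ : Fin m → Bool} {f f′ : Fin m → V n} →
  (∀ x → J x ≡ J′ x) → (∀ x → f x ≡ f′ x) → sumOver J f ≡ sumOver J′ f′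
sumOver-cong {zero}  eJ ef = refl
sumOver-cong {suc m} eJ ef =
  cong₂ _+v_ (cong₂ scale (eJ zero) (ef zero)) (sumOver-cong (λ x → eJ (suc x)) (λ x → ef (suc x)))

sumOver-empty : ∀ {m n} (J : Fin m → Bool) (f : Fin m → V n) → (∀ x → ¬ T (J x)) → sumOver J f ≡ 0v
sumOver-empty {zero}  J f none = refl
sumOver-empty {suc m} J f none with J zero | none zero
... | true  | n0 = ⊥-elim (n0 tt)
... | false | _  = trans (+v-identityˡ _) (sumOver-empty (λ x → J (suc x)) (λ x → f (suc x)) (λ x → none (suc x)))

sumOver-xor : ∀ {m n} (J K : Fin m → Bool) (f : Fin m → V n) →
  sumOver (λ x → J x xor K x) f ≡ sumOver J f +v sumOver K f
sumOver-xor {zero}  J K f = sym (+v-identityˡ 0v)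
sumOver-xor {suc m} J K f =
  trans (cong₂ _+v_ (scale-xor (J zero) (K zero) (f zero))
                    (sumOver-xor (λ x → J (suc x)) (λ x → K (suc x)) (λ x → f (suc x))))
        (+v-interchange _ _ _ _)

sumOver-point : ∀ {m n} (b : Bool) (i : Fin m) (f : Fin m → V n) →
  sumOver (λ x → b ∧ does (x ≟ i)) f ≡ scale b (f i)
sumOver-point false i f = sumOver-empty _ f (λ x ())
sumOver-point true zero f =
  trans (cong (f zero +v_) (sumOver-empty _ (λ x → f (suc x)) (λ x ()))) (+v-identityʳ (f zero))
sumOver-point true (suc i) f = trans (+v-identityˡ _) (sumOver-point true i (λ x → f (suc x)))

_without_ : ∀ {m} → (Fin m → Bool) → Fin m → Fin m → Bool
(J without i) x = J x ∧ not (does (x ≟ i))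

sumOver-remove : ∀ {m n} (J : Fin m → Bool) (i : Fin m) (f : Fin m → V n) →
  sumOver J f ≡ sumOver (J without i) f +v scale (J i) (f i)
sumOver-remove J i f = begin
  sumOver J f                                                   ≡⟨ sumOver-cong split (λ _ → refl) ⟩
  sumOver (λ x → (J without i) x xor (J i ∧ does (x ≟ i))) f   ≡⟨ sumOver-xor (J without i) _ f ⟩
  sumOver (J without i) f +v sumOver (λ x → J i ∧ does (x ≟ i)) f ≡⟨ cong (sumOver (J without i) f +v_) (sumOver-point (J i) i f) ⟩
  sumOver (J without i) f +v scale (J i) (f i)                  ∎
  where
  open ≡-Reasoning
  split : ∀ x → J x ≡ (J without i) x xor (J i ∧ does (x ≟ i))
  split x with x ≟ i
  ... | yes refl = lemma (J x)
    where
    lemma : ∀ b → b ≡ (b ∧ false) xor (b ∧ true)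
    lemma true  = refl
    lemma false = refl
  ... | no _ = lemma (J x) (J i)
    where
    lemma : ∀ a b → a ≡ (a ∧ true) xor (b ∧ false)
    lemma true  true  = refl
    lemma true  false = refl
    lemma false true  = refl
    lemma false false = refl

Additive : ∀ {n n′} → (V n → V n′) → Set
Additive L = ∀ x y → L (x +v y) ≡ L x +v L y

additive⇒0↦0 : ∀ {n n′} {L : V n → V n′} → Additive L → L 0v ≡ 0v
additive⇒0↦0 {L = L} additive = +v-cancelʳ (L 0v) (begin
  L 0v +v L 0v   ≡⟨ sym (additive 0v 0v) ⟩
  L (0v +v 0v)   ≡⟨ cong L (+v-identityˡ 0v) ⟩
  L 0v           ≡⟨ sym (+v-identityˡ (L 0v)) ⟩
  0v +v L 0v     ∎)
  where open ≡-Reasoning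

sumOver-linear : ∀ {m n n′} {L : V n → V n′} → Additive L →
  (J : Fin m → Bool) (f : Fin m → V n) → sumOver J (λ x → L (f x)) ≡ L (sumOver J f)
sumOver-linear {zero}  additive J f = sym (additive⇒0↦0 additive)
sumOver-linear {suc m} {L = L} additive J f =
  trans (cong₂ _+v_ (scale-commutes (J zero)) (sumOver-linear additive (λ x → J (suc x)) (λ x → f (suc x))))
        (sym (additive _ _))
  where
  scale-commutes : ∀ b → scale b (L (f zero)) ≡ L (scale b (f zero))
  scale-commutes true  = refl
  scale-commutes false = sym (additive⇒0↦0 additive)

image : ∀ {A : Set} {k} → DecidableEquality A → (Fin k → A) → A → Bool
image _≟ₐ_ g x = does (any? (λ j → x ≟ₐ g j))

image-sound : ∀ {A : Set} {k} (_≟ₐ_ : DecidableEquality A) (g : Fin k → A) {x} →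
  T (image _≟ₐ_ g x) → ∃ λ j → g j ≡ x
image-sound _≟ₐ_ g {x} t with any? (λ j → x ≟ₐ g j)
... | yes (j , x≡gj) = j , sym x≡gj

image-complete : ∀ {A : Set} {k} (_≟ₐ_ : DecidableEquality A) (g : Fin k → A) j → T (image _≟ₐ_ g (g j))
image-complete _≟ₐ_ g j with any? (λ j′ → g j ≟ₐ g j′)
... | yes _  = tt
... | no ¬gj = ¬gj (j , refl)

sumOver-reindex : ∀ {k m n} (g : Fin k → Fin m) → Injective _≡_ _≡_ g → (J : Fin m → Bool) →
  (∀ x → T (J x) → ∃ λ j → g j ≡ x) → (f : Fin m → V n) →
  sumOver J f ≡ sumOver (λ j → J (g j)) (λ j → f (g j))
sumOver-reindex {zero} g g-inj J support f = sumOver-empty J f (λ x t → case (support x t))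
  where
  case : ∀ {x} → ∃ (λ (j : Fin 0) → g j ≡ x) → ⊥
  case (() , _)
sumOver-reindex {suc k} g g-inj J support f = begin
  sumOver J f                                                       ≡⟨ sumOver-remove J (g zero) f ⟩
  sumOver (J without g zero) f +v scale (J (g zero)) (f (g zero))   ≡⟨ cong (_+v scale (J (g zero)) (f (g zero))) rest ⟩
  sumOver (λ j → J (g (suc j))) (λ j → f (g (suc j))) +v scale (J (g zero)) (f (g zero))
                                                                    ≡⟨ +v-comm _ _ ⟩
  sumOver (λ j → J (g j)) (λ j → f (g j))                           ∎
  where
  open ≡-Reasoning
  support′ : ∀ x → T ((J without g zero) x) → ∃ λ j → g (suc j) ≡ x
  support′ x t with x ≟ g zero
  ... | yes _ = ⊥-elim (T-∧ʳ {J x} t)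
  ... | no x≢g0 with support x (T-∧ˡ t)
  ...   | zero  , g0≡x = ⊥-elim (x≢g0 (sym g0≡x))
  ...   | suc j , gj≡x = j , gj≡x
  kept : ∀ j → (J without g zero) (g (suc j)) ≡ J (g (suc j))
  kept j with g (suc j) ≟ g zero
  ... | yes e = ⊥-elim (0≢1+n (sym (g-inj e)))
  ... | no _  = ∧-identityʳ (J (g (suc j)))
  rest : sumOver (J without g zero) f ≡ sumOver (λ j → J (g (suc j))) (λ j → f (g (suc j)))
  rest = trans (sumOver-reindex (λ j → g (suc j)) (λ e → suc-injective (g-inj e)) (J without g zero) support′ f)
               (sumOver-cong kept (λ _ → refl))

select : ∀ {k m} → (Fin k → Fin m) → (Fin k → Bool) → Fin m → Bool
select g s x = does (any? (λ j → T? (s j) ×-dec x ≟ g j))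

select-at : ∀ {k m} {g : Fin k → Fin m} → Injective _≡_ _≡_ g → ∀ s j → select g s (g j) ≡ s j
select-at {g = g} g-inj s j with any? (λ j′ → T? (s j′) ×-dec g j ≟ g j′) | s j in sj
... | yes _              | true  = refl
... | no ¬sel            | true  = ⊥-elim (¬sel (j , subst T (sym sj) tt , refl))
... | yes (j′ , t , eq)  | false = ⊥-elim (subst T (trans (cong s (sym (g-inj eq))) sj) t)
... | no _               | false = refl

select-support : ∀ {k m} (g : Fin k → Fin m) s x → T (select g s x) → ∃ λ j → T (s j) × g j ≡ x
select-support g s x t with any? (λ j → T? (s j) ×-dec x ≟ g j)
... | yes (j , sj , x≡gj) = j , sj , sym x≡gj

allV : ∀ n → (V n → Bool) → Bool
allV zero    P = P []
allV (suc n) P = allV n (λ v → P (true ∷ v)) ∧ allV n (λ v → P (false ∷ v))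

anyV : ∀ n → (V n → Bool) → Bool
anyV zero    P = P []
anyV (suc n) P = anyV n (λ v → P (true ∷ v)) ∨ anyV n (λ v → P (false ∷ v))

allV-≡-sound : ∀ n {P : V n → Bool} → allV n P ≡ true → ∀ v → P v ≡ true
allV-≡-sound zero        e []          = e
allV-≡-sound (suc n)     e (true ∷ v)  = allV-≡-sound n (proj₁ (∧≡true e)) v
allV-≡-sound (suc n) {P} e (false ∷ v) = allV-≡-sound n (proj₂ (∧≡true {allV n (λ v → P (true ∷ v))} e)) v

allV-sound : ∀ n {P : V n → Bool} → T (allV n P) → ∀ v → T (P v)
allV-sound n t v = Equivalence.from T-≡ (allV-≡-sound n (Equivalence.to T-≡ t) v)

allV-complete : ∀ n {P : V n → Bool} → (∀ v → T (P v)) → T (allV n P)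
allV-complete zero    all = all []
allV-complete (suc n) all = T-∧-intro (allV-complete n (λ v → all (true ∷ v))) (allV-complete n (λ v → all (false ∷ v)))

anyV-sound : ∀ n {P : V n → Bool} → T (anyV n P) → ∃ λ v → T (P v)
anyV-sound zero t = [] , t
anyV-sound (suc n) t with T-∨-split t
... | inj₁ t₁ = let (v , p) = anyV-sound n t₁ in true ∷ v , p
... | inj₂ t₀ = let (v , p) = anyV-sound n t₀ in false ∷ v , p

anyV-complete : ∀ n {P : V n → Bool} v → T (P v) → T (anyV n P)
anyV-complete zero    []          t = t
anyV-complete (suc n) (true ∷ v)  t = T-∨-introˡ (anyV-complete n v t)
anyV-complete (suc n) {P} (false ∷ v) t = T-∨-introʳ {anyV n (λ v → P (true ∷ v))} (anyV-complete n v t)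

findV : ∀ n → (V n → Bool) → V n
findV zero    P = []
findV (suc n) P =
  if anyV n (λ v → P (true ∷ v)) then true ∷ findV n (λ v → P (true ∷ v))
  else false ∷ findV n (λ v → P (false ∷ v))

allFin : ∀ {k} → (Fin k → Bool) → Bool
allFin {zero}  P = true
allFin {suc k} P = P zero ∧ allFin (λ j → P (suc j))

anyFin : ∀ {k} → (Fin k → Bool) → Bool
anyFin {zero}  P = false
anyFin {suc k} P = P zero ∨ anyFin (λ j → P (suc j))

allFin-sound : ∀ {k} {P : Fin k → Bool} → T (allFin P) → ∀ j → T (P j)
allFin-sound all zero    = T-∧ˡ all
allFin-sound {P = P} all (suc j) = allFin-sound (T-∧ʳ {P zero} all) j

anyFin-sound : ∀ {k} {P : Fin k → Bool} → T (anyFin P) → ∃ λ j → T (P j)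
anyFin-sound {suc k} any with T-∨-split any
... | inj₁ P0 = zero , P0
... | inj₂ rest = let (j , Pj) = anyFin-sound rest in suc j , Pj

-- Linear independence

Independent : ∀ {k n} → (Fin k → V n) → Set
Independent {k} u = ∀ (s : Fin k → Bool) → ∃ (λ j → T (s j)) → sumOver s u ≢ 0v

Ind⇒sum≢0 : ∀ {k m n} {f : Fin m → V n} {g : Fin k → Fin m} {I : Pred (Fin m) 0ℓ} →
  Injective _≡_ _≡_ g → Ind (colMat f) I →
  (s : Fin k → Bool) → (∀ j → T (s j) → I (g j)) → ∃ (λ j → T (s j)) → sumOver s (λ j → f (g j)) ≢ 0v
Ind⇒sum≢0 {f = f} {g} {I} g-inj ind s s⊆I (j , sj) sum≡0 =
  ind (select g s) select⊆I (g j , subst T (sym (select-at g-inj s j)) sj) (begin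
    sumOver (select g s) f                               ≡⟨ sumOver-reindex g g-inj (select g s) support f ⟩
    sumOver (λ j → select g s (g j)) (λ j → f (g j))     ≡⟨ sumOver-cong (select-at g-inj s) (λ _ → refl) ⟩
    sumOver s (λ j → f (g j))                            ≡⟨ sum≡0 ⟩
    0v                                                   ∎)
  where
  open ≡-Reasoning
  support : ∀ x → T (select g s x) → ∃ λ j → g j ≡ x
  support x t = let (j , _ , gj≡x) = select-support g s x t in j , gj≡x
  select⊆I : ⟦ select g s ⟧ ⊆ I
  select⊆I x t = let (j , sj , gj≡x) = select-support g s x t in subst I gj≡x (s⊆I j sj)

Ind⇒independent : ∀ {k m n} {f : Fin m → V n} {g : Fin k → Fin m} {I : Pred (Fin m) 0ℓ} →
  Injective _≡_ _≡_ g → (∀ j → I (g j)) → Ind (colMat f) I → Independent (λ j → f (g j))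
Ind⇒independent g-inj g∈I ind s = Ind⇒sum≢0 g-inj ind s (λ j _ → g∈I j)

independent⇒Ind-image : ∀ {k m n} {f : Fin m → V n} {g : Fin k → Fin m} → Injective _≡_ _≡_ g →
  Independent (λ j → f (g j)) → Ind (colMat f) ⟦ image _≟_ g ⟧
independent⇒Ind-image {f = f} {g} g-inj indep J J⊆image (x , Jx) sum≡0 =
  let (j , gj≡x) = support x Jx in
  indep (λ j → J (g j)) (j , subst (λ y → T (J y)) (sym gj≡x) Jx)
        (trans (sym (sumOver-reindex g g-inj J support f)) sum≡0)
  where
  support : ∀ y → T (J y) → ∃ λ j → g j ≡ y
  support y t = image-sound _≟_ g (J⊆image y t)

lin : ∀ {k n} → (Fin k → V n) → V k → V n
lin u w = sumOver (lookup w) u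

lin-additive : ∀ {k n} (u : Fin k → V n) → Additive (lin u)
lin-additive u x y = trans (sumOver-cong (λ j → lookup-zipWith _xor_ j x y) (λ _ → refl))
                           (sumOver-xor (lookup x) (lookup y) u)

lin-tabulate : ∀ {k n} (u : Fin k → V n) (s : Fin k → Bool) → lin u (tabulate s) ≡ sumOver s u
lin-tabulate u s = sumOver-cong (lookup∘tabulate s) (λ _ → refl)

unit : ∀ {k} → Fin k → V k
unit j = tabulate (λ i → does (i ≟ j))

lin-unit : ∀ {k n} (u : Fin k → V n) j → lin u (unit j) ≡ u j
lin-unit u j = trans (lin-tabulate u _) (sumOver-point true j u)

TrivialKernel : ∀ {k n} → (Fin k → V n) → Set
TrivialKernel u = ∀ w → lin u w ≡ 0v → w ≡ 0v

trivialKernel⇒independent : ∀ {k n} {u : Fin k → V n} → TrivialKernel u → Independent u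
trivialKernel⇒independent {u = u} ker s (j , sj) sum≡0 = subst T sj≡false sj
  where
  sj≡false : s j ≡ false
  sj≡false = begin
    s j                       ≡⟨ sym (lookup∘tabulate s j) ⟩
    lookup (tabulate s) j     ≡⟨ cong (λ w → lookup w j) (ker (tabulate s) (trans (lin-tabulate u s) sum≡0)) ⟩
    lookup 0v j               ≡⟨ lookup-replicate j false ⟩
    false                     ∎
    where open ≡-Reasoning

nonzero⇒coordinate : ∀ {n} (w : V n) → w ≢ 0v → ∃ λ j → T (lookup w j)
nonzero⇒coordinate []           w≢0 = ⊥-elim (w≢0 refl)
nonzero⇒coordinate (true ∷ w)  _   = zero , tt
nonzero⇒coordinate (false ∷ w) w≢0 =
  let (j , t) = nonzero⇒coordinate w (λ w≡0 → w≢0 (cong (false ∷_) w≡0)) in suc j , t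

independent⇒trivialKernel : ∀ {k n} {u : Fin k → V n} → Independent u → TrivialKernel u
independent⇒trivialKernel indep w lin≡0 with T? (isZero w)
... | yes w≡0 = ==-sound w≡0
... | no  w≢0 = ⊥-elim (indep (lookup w) (nonzero⇒coordinate w (λ w≡0 → w≢0 (==-complete w≡0))) lin≡0)

trivialKernel⇒injective : ∀ {k n} {u : Fin k → V n} → TrivialKernel u → Injective _≡_ _≡_ (lin u)
trivialKernel⇒injective {u = u} ker {x} {y} e =
  +v≡0⇒≡ (ker (x +v y) (trans (lin-additive u x y) (trans (cong (_+v lin u y) e) (+v-same (lin u y)))))

trivialKernelᵇ : ∀ {k n} → (Fin k → V n) → Bool
trivialKernelᵇ {k} u = allV k (λ w → isZero w ∨ not (isZero (lin u w)))

trivialKernelᵇ-sound : ∀ {k n} (u : Fin k → V n) → T (trivialKernelᵇ u) → TrivialKernel u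
trivialKernelᵇ-sound {k} u t w lin≡0 with T-∨-split (allV-sound k t w)
... | inj₁ w≡0   = ==-sound w≡0
... | inj₂ lin≢0 = ⊥-elim (≠-sound lin≢0 lin≡0)

trivialKernelᵇ-complete : ∀ {k n} (u : Fin k → V n) → TrivialKernel u → T (trivialKernelᵇ u)
trivialKernelᵇ-complete {k} u ker = allV-complete k λ w → case w (T? (isZero w))
  where
  case : ∀ w → Dec (T (isZero w)) → T (isZero w ∨ not (isZero (lin u w)))
  case w (yes w≡0) = T-∨-introˡ w≡0
  case w (no w≢0)  = T-∨-introʳ {isZero w} (T-not-intro (λ lin≡0 → w≢0 (==-complete (ker w (==-sound lin≡0)))))

independent-[] : ∀ {n} → Independent {0} {n} []ᶠ
independent-[] s (() , _)

independent-∷ : ∀ {k n} {u : Fin k → V n} {x : V n} → Independent u → (∀ w → lin u w ≢ x) → Independent (x ∷ᶠ u)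
independent-∷ {u = u} {x} indep x∉span s (j , sj) sum≡0 with s zero in s0 | sym (+v≡0⇒≡ sum≡0)
... | true  | rest≡x = x∉span (tabulate (λ i → s (suc i))) (trans (lin-tabulate u _) rest≡x)
... | false | rest≡0 with j
...   | zero   = subst T s0 sj
...   | suc j′ = indep (λ i → s (suc i)) (j′ , sj) rest≡0

independent₃ : ∀ {n} {x y z : V n} → x ≢ 0v → y ≢ 0v → z ≢ 0v → x ≢ y → x ≢ z → y ≢ z → x ≢ y +v z →
  Independent (x ∷ᶠ y ∷ᶠ z ∷ᶠ []ᶠ)
independent₃ {x = x} {y} {z} x≢0 y≢0 z≢0 x≢y x≢z y≢z x≢y+z =
  independent-∷ {u = y ∷ᶠ z ∷ᶠ []ᶠ}
    (independent-∷ {u = z ∷ᶠ []ᶠ} (independent-∷ {u = []ᶠ} independent-[] z∉span₀) y∉span₁) x∉span₂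
  where
  z∉span₀ : ∀ w → lin {0} []ᶠ w ≢ z
  z∉span₀ [] 0≡z = z≢0 (sym 0≡z)
  y∉span₁ : ∀ w → lin (z ∷ᶠ []ᶠ) w ≢ y
  y∉span₁ (true  ∷ []) e = y≢z (trans (sym e) (+v-identityʳ z))
  y∉span₁ (false ∷ []) e = y≢0 (trans (sym e) (+v-identityʳ 0v))
  x∉span₂ : ∀ w → lin (y ∷ᶠ z ∷ᶠ []ᶠ) w ≢ x
  x∉span₂ (true  ∷ true  ∷ []) e = x≢y+z (trans (sym e) (cong (y +v_) (+v-identityʳ z)))
  x∉span₂ (true  ∷ false ∷ []) e = x≢y (trans (sym e) (trans (cong (y +v_) (+v-identityʳ 0v)) (+v-identityʳ y)))
  x∉span₂ (false ∷ true  ∷ []) e = x≢z (trans (sym e) (trans (+v-identityˡ _) (+v-identityʳ z)))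
  x∉span₂ (false ∷ false ∷ []) e = x≢0 (trans (sym e) (trans (+v-identityˡ _) (+v-identityʳ 0v)))

injectiveᵇ : ∀ {k n} → (Fin k → V n) → Bool
injectiveᵇ B = allFin (λ i → allFin (λ j → does (i ≟ j) ∨ not (B i == B j)))

injectiveᵇ-sound : ∀ {k n} (B : Fin k → V n) → T (injectiveᵇ B) → Injective _≡_ _≡_ B
injectiveᵇ-sound B check {i} {j} Bi≡Bj with i ≟ j | allFin-sound (allFin-sound check i) j
... | yes i≡j | _      = i≡j
... | no _    | Bi≠Bj = ⊥-elim (≠-sound Bi≠Bj Bi≡Bj)

↣Fin⇒≤ : ∀ {a b} → Fin a ↣ Fin b → a ≤ b
↣Fin⇒≤ e = injective⇒≤ (Injection.injective e)

↔Fin⇒¬↔Fin : ∀ {X Y : Set} {k l} → X ↣ Y → Y ↣ X → Y ↔ Fin k → k ≢ l → ¬ (Fin l ↔ X)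
↔Fin⇒¬↔Fin X↣Y Y↣X Y↔k k≢l l↔X = k≢l (≤-antisym
  (↣Fin⇒≤ (↔⇒↣ (↔-sym l↔X) ↣-∘ (Y↣X ↣-∘ ↔⇒↣ (↔-sym Y↔k))))
  (↣Fin⇒≤ (↔⇒↣ Y↔k ↣-∘ (X↣Y ↣-∘ ↔⇒↣ l↔X))))

Subset-↔ : ∀ {k} (S : Subset k) → Σ (Fin k) (λ i → T (lookup S i)) ↔ Fin ∣ S ∣
Subset-↔ [] = mk↔ₛ′ (λ { (() , _) }) (λ ()) (λ ()) (λ { (() , _) })
Subset-↔ {suc k} (true ∷ S) = mk↔ₛ′ to from to∘from from∘to
  where
  ih : Σ (Fin k) (λ i → T (lookup S i)) ↔ Fin ∣ S ∣
  ih = Subset-↔ S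
  to : Σ (Fin (suc k)) (λ i → T (lookup (true ∷ S) i)) → Fin (suc ∣ S ∣)
  to (zero  , _) = zero
  to (suc i , t) = suc (Inverse.to ih (i , t))
  from : Fin (suc ∣ S ∣) → Σ (Fin (suc k)) (λ i → T (lookup (true ∷ S) i))
  from zero    = zero , tt
  from (suc y) = suc (proj₁ (Inverse.from ih y)) , proj₂ (Inverse.from ih y)
  to∘from : ∀ y → to (from y) ≡ y
  to∘from zero    = refl
  to∘from (suc y) = cong suc (Inverse.strictlyInverseˡ ih y)
  from∘to : ∀ x → from (to x) ≡ x
  from∘to (zero  , _) = refl
  from∘to (suc i , t) = cong (λ (x : Σ (Fin k) (λ i → T (lookup S i))) → suc (proj₁ x) , proj₂ x)
                             (Inverse.strictlyInverseʳ ih (i , t))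
Subset-↔ {suc k} (false ∷ S) = mk↔ₛ′ to from (Inverse.strictlyInverseˡ ih) from∘to
  where
  ih : Σ (Fin k) (λ i → T (lookup S i)) ↔ Fin ∣ S ∣
  ih = Subset-↔ S
  to : Σ (Fin (suc k)) (λ i → T (lookup (false ∷ S) i)) → Fin ∣ S ∣
  to (suc i , t) = Inverse.to ih (i , t)
  from : Fin ∣ S ∣ → Σ (Fin (suc k)) (λ i → T (lookup (false ∷ S) i))
  from y = suc (proj₁ (Inverse.from ih y)) , proj₂ (Inverse.from ih y)
  from∘to : ∀ x → from (to x) ≡ x
  from∘to (suc i , t) = cong (λ (x : Σ (Fin k) (λ i → T (lookup S i))) → suc (proj₁ x) , proj₂ x)
                             (Inverse.strictlyInverseʳ ih (i , t))

countV : ∀ n → (V n → Bool) → ℕ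
countV zero    P = if P [] then 1 else 0
countV (suc n) P = countV n (λ v → P (true ∷ v)) + countV n (λ v → P (false ∷ v))

countV-↔ : ∀ n (P : V n → Bool) → Σ (V n) (λ v → T (P v)) ↔ Fin (countV n P)
countV-↔ zero P = T-↔ (P []) ↔-∘ mk↔ₛ′ (λ { ([] , t) → t }) ([] ,_) (λ _ → refl) (λ { ([] , _) → refl })
  where
  T-↔ : ∀ b → T b ↔ Fin (if b then 1 else 0)
  T-↔ true  = mk↔ₛ′ (λ _ → zero) (λ _ → tt) (λ { zero → refl }) (λ _ → refl)
  T-↔ false = mk↔ₛ′ (λ ()) (λ ()) (λ ()) (λ ())
countV-↔ (suc n) P =
  ↔-sym +↔⊎ ↔-∘ ((countV-↔ n (λ v → P (true ∷ v)) ⊎-↔ countV-↔ n (λ v → P (false ∷ v))) ↔-∘ splitHead)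
  where
  splitHead : Σ (V (suc n)) (λ v → T (P v)) ↔
              (Σ (V n) (λ v → T (P (true ∷ v))) ⊎ Σ (V n) (λ v → T (P (false ∷ v))))
  splitHead = mk↔ₛ′ (λ { (true ∷ v , t) → inj₁ (v , t) ; (false ∷ v , t) → inj₂ (v , t) })
                    (λ { (inj₁ (v , t)) → true ∷ v , t ; (inj₂ (v , t)) → false ∷ v , t })
                    (λ { (inj₁ _) → refl ; (inj₂ _) → refl })
                    (λ { (true ∷ _ , _) → refl ; (false ∷ _ , _) → refl })

Hereditary : Matroid → Set₁
Hereditary M = ∀ {I J : Pred (E M) 0ℓ} → I ⊆ J → Ind M J → Ind M I

Rank≤ : ℕ → Matroid → Set₁
Rank≤ k M = ∀ I → Ind M I → (f : Fin (suc k) → E M) → Injective _≡_ _≡_ f → (∀ j → I (f j)) → ⊥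

Range : ∀ {A : Set} {k} → (Fin k → A) → Pred A 0ℓ
Range f x = ∃ λ j → f j ≡ x

IndependentIn : (M : Matroid) → (E M → Bool) → ℕ → Set
IndependentIn M F k =
  Σ[ f ∈ (Fin k → E M) ] Injective _≡_ _≡_ f × (∀ j → T (F (f j))) × Ind M (Range f)

colMat-hereditary : ∀ {n m} (A : Fin m → V n) → Hereditary (colMat A)
colMat-hereditary A I⊆J ind K K⊆I = ind K (λ x t → I⊆J x (K⊆I x t))

∣-hereditary : ∀ {M F} → Hereditary M → Hereditary (M ∣ F)
∣-hereditary her I⊆J = her (λ x (s , p) → s , I⊆J (x , s) p)

／-hereditary : ∀ {M C} → Hereditary M → Hereditary (M ／ C)
／-hereditary {C = C} her {I} {J} I⊆J (B , basis , ind) = B , basis , her grow ind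
  where
  grow : (lift (λ e → not (C e)) I ∪ ⟦ B ⟧) ⊆ (lift (λ e → not (C e)) J ∪ ⟦ B ⟧)
  grow x (inj₁ (s , p)) = inj₁ (s , I⊆J (x , s) p)
  grow x (inj₂ b)       = inj₂ b

proj₁-injective : ∀ {A : Set} {P : A → Bool} → Injective _≡_ _≡_ (proj₁ {B = λ a → T (P a)})
proj₁-injective {x = a , s} {.a , t} refl = cong (a ,_) (T-irrelevant s t)

Σ-≟ : ∀ {A : Set} {P : A → Bool} → DecidableEquality A → DecidableEquality (Σ A (λ a → T (P a)))
Σ-≟ _≟ₐ_ (x , _) (y , _) = map′ proj₁-injective (cong proj₁) (x ≟ₐ y)

∣-rank≤ : ∀ {k M F} → Rank≤ k M → Rank≤ k (M ∣ F)
∣-rank≤ {F = F} rank I ind f f-inj f∈I =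
  rank (lift F I) ind (λ j → proj₁ (f j)) (λ e → f-inj (proj₁-injective e)) (λ j → proj₂ (f j) , f∈I j)

／-rank≤ : ∀ {k M C} → Rank≤ k M → Rank≤ k (M ／ C)
／-rank≤ rank I (_ , _ , ind) f f-inj f∈I =
  rank _ ind (λ j → proj₁ (f j)) (λ e → f-inj (proj₁-injective e)) (λ j → inj₁ (proj₂ (f j) , f∈I j))

pair-lift : ∀ {A : Set} {P : A → Bool} (e f : Σ A (λ a → T (P a))) →
  lift P (pair e f) ⊆ pair (proj₁ e) (proj₁ f)
pair-lift e f x (_ , inj₁ p) = inj₁ (cong proj₁ p)
pair-lift e f x (_ , inj₂ p) = inj₂ (cong proj₁ p)

∣-simple : ∀ {M F} → Hereditary M → Simple M → Simple (M ∣ F)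
∣-simple her simple e f = her (pair-lift e f) (simple (proj₁ e) (proj₁ f))

simplification-simple : ∀ {K S} → Hereditary K → IsSimplificationSet K S → Simple (K ∣ S)
simplification-simple her (pairs , _) e f = her (pair-lift e f) (pairs (proj₁ e) (proj₁ f) (proj₂ e) (proj₂ f))

∷ᶠ-injective : ∀ {A : Set} {k} {a : A} {f : Fin k → A} →
  (∀ j → a ≢ f j) → Injective _≡_ _≡_ f → Injective _≡_ _≡_ (a ∷ᶠ f)
∷ᶠ-injective fresh f-inj {zero}  {zero}  e = refl
∷ᶠ-injective fresh f-inj {zero}  {suc j} e = ⊥-elim (fresh j e)
∷ᶠ-injective fresh f-inj {suc i} {zero}  e = ⊥-elim (fresh i (sym e))
∷ᶠ-injective fresh f-inj {suc i} {suc j} e = cong suc (f-inj e)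

contracted≢ : ∀ {A : Set} {C : A → Bool} {b : A} (x : Σ A (λ a → T (not (C a)))) → T (C b) → b ≢ proj₁ x
contracted≢ (_ , ¬Cx) Cb refl = T-not-elim ¬Cx Cb

basis-nonempty : ∀ {M C B x} → Hereditary M → Simple M → IsBasisOf M C B → T (C x) →
  ¬ ¬ ∃ λ b → T (B b)
basis-nonempty {B = B} {x} her simple (_ , _ , maximal) Cx noB =
  maximal x Cx (λ Bx → noB (x , Bx)) (her B∪x⊆x (simple x x))
  where
  B∪x⊆x : (⟦ B ⟧ ∪ ｛ x ｝) ⊆ pair x x
  B∪x⊆x y (inj₁ By)  = ⊥-elim (noB (y , By))
  B∪x⊆x y (inj₂ y≡x) = inj₁ y≡x

basis-two : ∀ {M C B x y} → Hereditary M → Simple M → DecidableEquality (E M) → IsBasisOf M C B →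
  T (C x) → T (C y) → x ≢ y → ¬ ¬ ∃₂ λ b b′ → T (B b) × T (B b′) × b ≢ b′
basis-two {M} {C} {B} {x} {y} her simple _≟ₘ_ basis Cx Cy x≢y no-two =
  basis-nonempty her simple basis Cx λ (b , Bb) →
    let (z , Cz , z≢b) = other b in
    proj₂ (proj₂ basis) z Cz (λ Bz → no-two (b , z , Bb , Bz , λ b≡z → z≢b (sym b≡z)))
      (her (B∪z⊆bz b Bb z) (simple b z))
  where
  other : ∀ b → ∃ λ z → T (C z) × z ≢ b
  other b with x ≟ₘ b
  ... | yes refl = y , Cy , λ y≡x → x≢y (sym y≡x)
  ... | no x≢b   = x , Cx , x≢b
  B∪z⊆bz : ∀ b → T (B b) → ∀ z → (⟦ B ⟧ ∪ ｛ z ｝) ⊆ pair b z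
  B∪z⊆bz b Bb z w (inj₁ Bw)  = inj₁ (decidable-stable (w ≟ₘ b) (λ w≢b → no-two (w , b , Bw , Bb , w≢b)))
  B∪z⊆bz b Bb z w (inj₂ w≡z) = inj₂ w≡z

／-rank≤-drop : ∀ {k M C x} → Hereditary M → Simple M → T (C x) → Rank≤ (suc k) M → Rank≤ k (M ／ C)
／-rank≤-drop her simple Cx rank I (B , basis , ind) f f-inj f∈I =
  basis-nonempty her simple basis Cx λ (b , Bb) →
    rank _ ind (b ∷ᶠ λ j → proj₁ (f j))
         (∷ᶠ-injective (λ j → contracted≢ (f j) (proj₁ basis b Bb)) (λ e → f-inj (proj₁-injective e)))
         (λ { zero → inj₂ Bb ; (suc j) → inj₁ (proj₂ (f j) , f∈I j) })

／-rank≤-drop₂ : ∀ {k M C x y} → Hereditary M → Simple M → DecidableEquality (E M) →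
  T (C x) → T (C y) → x ≢ y → Rank≤ (suc (suc k)) M → Rank≤ k (M ／ C)
／-rank≤-drop₂ her simple _≟ₘ_ Cx Cy x≢y rank I (B , basis , ind) f f-inj f∈I =
  basis-two her simple _≟ₘ_ basis Cx Cy x≢y λ (b , b′ , Bb , Bb′ , b≢b′) →
    rank _ ind (b ∷ᶠ b′ ∷ᶠ λ j → proj₁ (f j))
         (∷ᶠ-injective (λ { zero → b≢b′ ; (suc j) → contracted≢ (f j) (proj₁ basis b Bb) })
           (∷ᶠ-injective (λ j → contracted≢ (f j) (proj₁ basis b′ Bb′)) (λ e → f-inj (proj₁-injective e))))
         (λ { zero → inj₂ Bb ; (suc zero) → inj₂ Bb′ ; (suc (suc j)) → inj₁ (proj₂ (f j) , f∈I j) })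

／-point : ∀ {M C p} → Hereditary M → Simple M → (∀ x → T (C x) → x ≡ p) → T (C p) →
  ∀ I → Ind (M ／ C) I ⇔ Ind M (lift (λ e → not (C e)) I ∪ ｛ p ｝)
／-point {M} {C} {p} her simple only-p Cp I = mk⇔ to from
  where
  to : Ind (M ／ C) I → Ind M (lift (λ e → not (C e)) I ∪ ｛ p ｝)
  to (B , (B⊆C , _ , maximal) , ind) with T? (B p)
  ... | yes Bp = her (λ { y (inj₁ q) → inj₁ q ; y (inj₂ refl) → inj₂ Bp }) ind
  ... | no ¬Bp = ⊥-elim (maximal p Cp ¬Bp (her B∪p⊆p (simple p p)))
    where
    B∪p⊆p : (⟦ B ⟧ ∪ ｛ p ｝) ⊆ pair p p
    B∪p⊆p y (inj₁ By)  = inj₁ (only-p y (B⊆C y By))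
    B∪p⊆p y (inj₂ y≡p) = inj₁ y≡p
  from : Ind M (lift (λ e → not (C e)) I ∪ ｛ p ｝) → Ind (M ／ C) I
  from ind = C , ((λ _ Cx → Cx) , her (λ y Cy → inj₂ (only-p y Cy)) ind , (λ e Ce ¬Ce → ⊥-elim (¬Ce Ce))) ,
             her (λ { y (inj₁ q) → inj₁ q ; y (inj₂ Cy) → inj₂ (only-p y Cy) }) ind

flat-full : ∀ {k M F} → Hereditary M → DecidableEquality (E M) → Rank≤ k M → Flat M F →
  IndependentIn M F k → ∀ x → T (F x)
flat-full {M = M} {F} her _≟ₘ_ rank flat (f , f-inj , f∈F , ind) x with T? (F x)
... | yes Fx = Fx
... | no ¬Fx = flat x (image _≟ₘ_ f , image⊆F , her image⊆Range ind , dependent)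
  where
  image⊆Range : ⟦ image _≟ₘ_ f ⟧ ⊆ Range f
  image⊆Range y t = image-sound _≟ₘ_ f t
  image⊆F : ⟦ image _≟ₘ_ f ⟧ ⊆ ⟦ F ⟧
  image⊆F y t = let (j , fj≡y) = image-sound _≟ₘ_ f t in subst (λ z → T (F z)) fj≡y (f∈F j)
  dependent : ¬ Ind M (⟦ image _≟ₘ_ f ⟧ ∪ ｛ x ｝)
  dependent ind′ = rank _ ind′ (x ∷ᶠ f)
    (∷ᶠ-injective (λ j x≡fj → ¬Fx (subst (λ z → T (F z)) (sym x≡fj) (f∈F j))) f-inj)
    (λ { zero → inj₂ refl ; (suc j) → inj₁ (image-complete _≟ₘ_ f j) })

¬IndependentIn⇒rank≤ : ∀ {k M F} → Hereditary M → ¬ IndependentIn M F (suc k) → Rank≤ k (M ∣ F)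
¬IndependentIn⇒rank≤ her none I ind f f-inj f∈I =
  none ((λ j → proj₁ (f j)) , (λ e → f-inj (proj₁-injective e)) , (λ j → proj₂ (f j)) ,
        her (λ { _ (j , refl) → proj₂ (f j) , f∈I j }) ind)

↔-injective : ∀ {A B : Set} (φ : A ↔ B) → Injective _≡_ _≡_ (Inverse.to φ)
↔-injective φ = Injection.injective (↔⇒↣ φ)

≅-hereditary : ∀ {N M} → N ≅ M → Hereditary M → Hereditary N
≅-hereditary (φ , ind⇔) her {I} {J} I⊆J indJ =
  Equivalence.from (ind⇔ I) (her (λ y → I⊆J (Inverse.from φ y)) (Equivalence.to (ind⇔ J) indJ))

≅-simple : ∀ {N M} → N ≅ M → Hereditary M → Simple M → Simple N
≅-simple (φ , ind⇔) her simple e f =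
  Equivalence.from (ind⇔ (pair e f)) (her moved (simple (Inverse.to φ e) (Inverse.to φ f)))
  where
  moved : (λ y → pair e f (Inverse.from φ y)) ⊆ pair (Inverse.to φ e) (Inverse.to φ f)
  moved y (inj₁ p) = inj₁ (trans (sym (Inverse.strictlyInverseˡ φ y)) (cong (Inverse.to φ) p))
  moved y (inj₂ p) = inj₂ (trans (sym (Inverse.strictlyInverseˡ φ y)) (cong (Inverse.to φ) p))

≅-rank≤ : ∀ {k N M} → N ≅ M → Rank≤ k M → Rank≤ k N
≅-rank≤ (φ , ind⇔) rank I ind f f-inj f∈I =
  rank _ (Equivalence.to (ind⇔ I) ind) (λ j → Inverse.to φ (f j)) (λ e → f-inj (↔-injective φ e))
       (λ j → subst I (sym (Inverse.strictlyInverseʳ φ (f j))) (f∈I j))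

≅-≟ : ∀ {N M} → N ≅ M → DecidableEquality (E M) → DecidableEquality (E N)
≅-≟ (φ , _) _≟ₘ_ x y = map′ (↔-injective φ) (cong (Inverse.to φ)) (Inverse.to φ x ≟ₘ Inverse.to φ y)

≅-trans : ∀ {K N M} → K ≅ N → N ≅ M → K ≅ M
≅-trans (φ , ind⇔) (ψ , ind⇔′) = (ψ ↔-∘ φ) , λ I →
  mk⇔ (λ ind → Equivalence.to (ind⇔′ _) (Equivalence.to (ind⇔ I) ind))
      (λ ind → Equivalence.from (ind⇔ I) (Equivalence.from (ind⇔′ _) ind))

≅-sym : ∀ {N M} → Hereditary M → N ≅ M → M ≅ N
≅-sym {N} {M} her (φ , ind⇔) = ↔-sym φ , λ I →
  mk⇔ (λ ind → Equivalence.from (ind⇔ (λ x → I (Inverse.to φ x))) (her (λ y → subst I (Inverse.strictlyInverseˡ φ y)) ind))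
      (λ ind → her (λ y → subst I (sym (Inverse.strictlyInverseˡ φ y))) (Equivalence.to (ind⇔ (λ x → I (Inverse.to φ x))) ind))

∣-≅ : ∀ {N M F} (φ : N ≅ M) → (N ∣ F) ≅ (M ∣ (λ y → F (Inverse.from (proj₁ φ) y)))
∣-≅ {N} {M} {F} (φ , ind⇔) = ψ , λ I → ind⇔ (lift F I)
  where
  ψ : E (N ∣ F) ↔ E (M ∣ (λ y → F (Inverse.from φ y)))
  ψ = mk↔ₛ′ (λ (x , Fx) → Inverse.to φ x , subst (λ z → T (F z)) (sym (Inverse.strictlyInverseʳ φ x)) Fx)
            (λ (y , Fy) → Inverse.from φ y , Fy)
            (λ (y , _) → proj₁-injective (Inverse.strictlyInverseˡ φ y))
            (λ (x , _) → proj₁-injective (Inverse.strictlyInverseʳ φ x))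

≅-flat : ∀ {N M F} → Hereditary M → (φ : N ≅ M) → Flat N F → Flat M (λ y → F (Inverse.from (proj₁ φ) y))
≅-flat {N} {M} {F} her (φ , ind⇔) flat e (I , I⊆F , ind , dependent) =
  flat (Inverse.from φ e) (I′ , I′⊆F , ind′ , dependent′)
  where
  I′ : E N → Bool
  I′ x = I (Inverse.to φ x)
  I′⊆F : ⟦ I′ ⟧ ⊆ ⟦ F ⟧
  I′⊆F x t = subst (λ z → T (F z)) (Inverse.strictlyInverseʳ φ x) (I⊆F (Inverse.to φ x) t)
  ind′ : Ind N ⟦ I′ ⟧
  ind′ = Equivalence.from (ind⇔ ⟦ I′ ⟧) (her (λ y → subst (λ z → T (I z)) (Inverse.strictlyInverseˡ φ y)) ind)
  dependent′ : ¬ Ind N (⟦ I′ ⟧ ∪ ｛ Inverse.from φ e ｝)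
  dependent′ indN = dependent (her moved (Equivalence.to (ind⇔ _) indN))
    where
    moved : (⟦ I ⟧ ∪ ｛ e ｝) ⊆ (λ y → (⟦ I′ ⟧ ∪ ｛ Inverse.from φ e ｝) (Inverse.from φ y))
    moved y (inj₁ t)   = inj₁ (subst (λ z → T (I z)) (sym (Inverse.strictlyInverseˡ φ y)) t)
    moved y (inj₂ y≡e) = inj₂ (cong (Inverse.from φ) y≡e)

∣-full≅ : ∀ {M F} → Hereditary M → (∀ x → T (F x)) → (M ∣ F) ≅ M
∣-full≅ {M} {F} her full = φ , λ I →
  mk⇔ (her (λ y p → full y , p))
      (her (λ { y (s , p) → subst I (proj₁-injective refl) p }))
  where
  φ : E (M ∣ F) ↔ E M
  φ = mk↔ₛ′ proj₁ (λ x → x , full x) (λ _ → refl) (λ _ → proj₁-injective refl)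

／∅∣≅ : ∀ {M C S} → Hereditary M → Simple M → (∀ x → ¬ T (C x)) →
  IsSimplificationSet (M ／ C) S → ((M ／ C) ∣ S) ≅ M
／∅∣≅ {M} {C} {S} her simple C-empty (_ , represented) = φ , λ I →
  mk⇔ (to-ind I) (from-ind I)
  where
  uncontracted : ∀ x → T (not (C x))
  uncontracted x = T-not-intro (C-empty x)
  C-basis : ∀ {J} → Ind M J → IsBasisOf M C C
  C-basis ind = (λ _ Cx → Cx) , her (λ y Cy → ⊥-elim (C-empty y Cy)) ind , (λ y Cy → ⊥-elim (C-empty y Cy))
  pairs-independent : ∀ (e f : E (M ／ C)) → Ind (M ／ C) (pair e f)
  pairs-independent e f = C , C-basis (simple (proj₁ e) (proj₁ f)) ,
    her (λ { y (inj₁ q) → pair-lift e f y q ; y (inj₂ Cy) → ⊥-elim (C-empty y Cy) }) (simple (proj₁ e) (proj₁ f))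
  all-represented : ∀ e → T (S e)
  all-represented e with represented e (／-hereditary her (λ y q → inj₁ q) (pairs-independent e e))
  ... | f , Sf , inj₁ f≡e  = subst (λ z → T (S z)) f≡e Sf
  ... | f , Sf , inj₂ dep = ⊥-elim (dep (pairs-independent e f))
  φ : E ((M ／ C) ∣ S) ↔ E M
  φ = mk↔ₛ′ (λ x → proj₁ (proj₁ x)) (λ x → (x , uncontracted x) , all-represented (x , uncontracted x))
            (λ _ → refl) (λ _ → proj₁-injective (proj₁-injective refl))
  to-ind : ∀ I → Ind ((M ／ C) ∣ S) I → Ind M (λ y → I (Inverse.from φ y))
  to-ind I (_ , _ , ind) = her (λ y p → inj₁ (uncontracted y , all-represented _ , p)) ind
  from-ind : ∀ I → Ind M (λ y → I (Inverse.from φ y)) → Ind ((M ／ C) ∣ S) I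
  from-ind I ind = C , C-basis ind , her chosen ind
    where
    chosen : (lift (λ e → not (C e)) (lift S I) ∪ ⟦ C ⟧) ⊆ (λ y → I (Inverse.from φ y))
    chosen y (inj₁ (_ , _ , p)) = subst I (proj₁-injective (proj₁-injective refl)) p
    chosen y (inj₂ Cy)          = ⊥-elim (C-empty y Cy)

-- M(K4) in rank at most three

K4-star : Fin 3 → Fin 6
K4-star i = i ↑ˡ 3

K4-star-independent : Ind MK4 ⟦ image _≟_ K4-star ⟧
K4-star-independent = independent⇒Ind-image {f = incK4} {g = K4-star} (λ {i} {j} → ↑ˡ-injective 3 i j)
  (trivialKernel⇒independent {u = λ j → incK4 (K4-star j)} (trivialKernelᵇ-sound (λ j → incK4 (K4-star j)) tt))

¬K4≼-rank≤2 : ∀ {M} → Rank≤ 2 M → ¬ (MK4 ≼ M)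
¬K4≼-rank≤2 rank (done (φ , ind⇔)) =
  rank _ (Equivalence.to (ind⇔ ⟦ image _≟_ K4-star ⟧) K4-star-independent) (λ j → Inverse.to φ (K4-star j))
       (λ e → ↑ˡ-injective 3 _ _ (↔-injective φ e))
       (λ j → subst (λ x → T (image _≟_ K4-star x)) (sym (Inverse.strictlyInverseʳ φ (K4-star j)))
                    (image-complete _≟_ K4-star j))
¬K4≼-rank≤2 rank (restr F _ d)     = ¬K4≼-rank≤2 (∣-rank≤ rank) d
¬K4≼-rank≤2 rank (contr C S _ d)   = ¬K4≼-rank≤2 (∣-rank≤ (／-rank≤ rank)) d

record SimpleRank≤3Not6 (M : Matroid) : Set₁ where
  field
    hereditary : Hereditary M
    simple     : Simple M
    rank≤3     : Rank≤ 3 M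
    not6       : ¬ (Fin 6 ↔ E M)
    _≟ₘ_       : DecidableEquality (E M)

≅-SimpleRank≤3Not6 : ∀ {N M} → N ≅ M → SimpleRank≤3Not6 M → SimpleRank≤3Not6 N
≅-SimpleRank≤3Not6 {N} {M} N≅M inv = record
  { hereditary = ≅-hereditary N≅M hereditary
  ; simple     = ≅-simple N≅M hereditary simple
  ; rank≤3     = ≅-rank≤ N≅M rank≤3
  ; not6       = λ φ → not6 (proj₁ N≅M ↔-∘ φ)
  ; _≟ₘ_       = ≅-≟ {N} {M} N≅M _≟ₘ_
  }
  where open SimpleRank≤3Not6 inv

¬K4≼-rank≤3 : ∀ {M} → SimpleRank≤3Not6 M → ¬ (MK4 ≼ M)
¬K4≼-rank≤3 inv (done (φ , _)) = SimpleRank≤3Not6.not6 inv φ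
¬K4≼-rank≤3 {M} inv (restr F flat d) = ¬¬-excluded-middle λ
  { (yes spanning) → ¬K4≼-rank≤3
      (≅-SimpleRank≤3Not6 (∣-full≅ {M} hereditary (flat-full {M = M} hereditary _≟ₘ_ rank≤3 flat spanning)) inv) d
  ; (no ¬spanning) → ¬K4≼-rank≤2 (¬IndependentIn⇒rank≤ {M = M} hereditary ¬spanning) d
  }
  where open SimpleRank≤3Not6 inv
¬K4≼-rank≤3 {M} inv (contr C S simplification d) = ¬¬-excluded-middle {A = ∃ λ x → T (C x)} λ
  { (yes (x , Cx)) → ¬K4≼-rank≤2 (∣-rank≤ {M = M ／ C} {S} (／-rank≤-drop {M = M} hereditary simple Cx rank≤3)) d
  ; (no C-empty)   → ¬K4≼-rank≤3
      (≅-SimpleRank≤3Not6 (／∅∣≅ {M} hereditary simple (λ x Cx → C-empty (x , Cx)) simplification) inv) d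
  }
  where open SimpleRank≤3Not6 inv

-- Coordinates

≤∣∣ : ∀ {l m} (S : Subset m) (f : Fin l → Fin m) → Injective _≡_ _≡_ f → (∀ j → T (lookup S (f j))) → l ≤ ∣ S ∣
≤∣∣ S f f-inj f∈S = ↣Fin⇒≤ (↔⇒↣ (Subset-↔ S) ↣-∘ mk↣ {to = λ j → f j , f∈S j} (λ e → f-inj (cong proj₁ e)))

HasRank⇒rank≤ : ∀ {n m k} {A : Fin m → V n} → HasRank A k → Rank≤ k (colMat A)
HasRank⇒rank≤ {m = m} {k} {A} (_ , bounded) I ind f f-inj f∈I =
  n≮n k (≤-trans (≤∣∣ S f f-inj f∈S) (bounded S (colMat-hereditary A S⊆I ind)))
  where
  S : Subset m
  S = tabulate (image _≟_ f)
  f∈S : ∀ j → T (lookup S (f j))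
  f∈S j = subst T (sym (lookup∘tabulate (image _≟_ f) (f j))) (image-complete _≟_ f j)
  S⊆I : (_∈ S) ⊆ I
  S⊆I x x∈S = let (j , fj≡x) = image-sound _≟_ f in-image in subst I fj≡x (f∈I j)
    where
    in-image : T (image _≟_ f x)
    in-image = subst T (trans (sym ([]=⇒lookup x∈S)) (lookup∘tabulate (image _≟_ f) x)) tt

module Coordinates {n m k} {A : Fin m → V n} (rank : HasRank A k) where

  private
    S = proj₁ (proj₁ rank)

  basis-↔ : Σ (Fin m) (λ i → T (lookup S i)) ↔ Fin k
  basis-↔ = subst (λ l → Σ (Fin m) (λ i → T (lookup S i)) ↔ Fin l) (proj₁ (proj₂ (proj₁ rank))) (Subset-↔ S)

  basis : Fin k → Fin m
  basis j = proj₁ (Inverse.from basis-↔ j)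

  basis-injective : Injective _≡_ _≡_ basis
  basis-injective e = Injection.injective (↔⇒↣ (↔-sym basis-↔)) (proj₁-injective e)

  basis-independent : Independent (λ j → A (basis j))
  basis-independent = Ind⇒independent basis-injective
    (λ j → lookup⇒[]= (basis j) S (Equivalence.to T-≡ (proj₂ (Inverse.from basis-↔ j))))
    (proj₂ (proj₂ (proj₁ rank)))

  spanned : ∀ i → ∃ λ s → lin (λ j → A (basis j)) s ≡ A i
  spanned i with T? (anyV k (λ s → lin (λ j → A (basis j)) s == A i))
  ... | yes found = let (s , e) = anyV-sound k found in s , ==-sound e
  ... | no ¬found = ⊥-elim (HasRank⇒rank≤ rank _ enlarged-independent (i ∷ᶠ basis) enlarged-injective
                                          (image-complete _≟_ (i ∷ᶠ basis)))
    where
    outside : ∀ s → lin (λ j → A (basis j)) s ≢ A i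
    outside s e = ¬found (anyV-complete k s (==-complete e))
    enlarged-injective : Injective _≡_ _≡_ (i ∷ᶠ basis)
    enlarged-injective = ∷ᶠ-injective (λ j i≡bj → outside (unit j) (trans (lin-unit _ j) (cong A (sym i≡bj))))
                                      basis-injective
    enlarged-independent : Ind (colMat A) ⟦ image _≟_ (i ∷ᶠ basis) ⟧
    enlarged-independent = independent⇒Ind-image enlarged-injective
      (independent-∷ {u = λ j → A (basis j)} basis-independent outside)

  -- Abstract, so that the type checker never expands the search hidden in `spanned`.
  abstract
    c : Fin m → V k
    c i = proj₁ (spanned i)

    c-spans : ∀ i → lin (λ j → A (basis j)) (c i) ≡ A i
    c-spans i = proj₂ (spanned i)

  sum-in-coordinates : ∀ J → sumOver J A ≡ lin (λ j → A (basis j)) (sumOver J c)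
  sum-in-coordinates J = trans (sumOver-cong (λ _ → refl) (λ i → sym (c-spans i)))
                               (sumOver-linear (lin-additive _) J c)

  colMat≅ : colMat A ≅ colMat c
  colMat≅ = ↔-refl , λ I → mk⇔
    (λ ind J J⊆I ne sum≡0 → ind J J⊆I ne (trans (sum-in-coordinates J)
                                            (trans (cong (lin (λ j → A (basis j))) sum≡0) (additive⇒0↦0 (lin-additive (λ j → A (basis j)))))))
    (λ ind J J⊆I ne sum≡0 → ind J J⊆I ne (independent⇒trivialKernel basis-independent _
                                            (trans (sym (sum-in-coordinates J)) sum≡0)))

simple⇒nonzero : ∀ {n m} {c : Fin m → V n} → Simple (colMat c) → ∀ i → c i ≢ 0v
simple⇒nonzero {c = c} simple i ci≡0 =
  Ind⇒independent {g = λ (_ : Fin 1) → i} (λ { {zero} {zero} _ → refl }) (λ _ → inj₁ refl) (simple i i)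
    (λ _ → true) (zero , tt) (trans (+v-identityʳ (c i)) ci≡0)

simple⇒injective : ∀ {n m} {c : Fin m → V n} → Simple (colMat c) → Injective _≡_ _≡_ c
simple⇒injective {c = c} simple {i} {j} ci≡cj with i ≟ j
... | yes i≡j = i≡j
... | no  i≢j = ⊥-elim (Ind⇒independent {g = i ∷ᶠ j ∷ᶠ []ᶠ}
      (∷ᶠ-injective (λ { zero → i≢j ; (suc ()) }) (∷ᶠ-injective (λ ()) (λ { {()} })))
      (λ { zero → inj₁ refl ; (suc zero) → inj₂ refl }) (simple i j) (λ _ → true) (zero , tt) sum≡0)
  where
  sum≡0 : c i +v (c j +v 0v) ≡ 0v
  sum≡0 = trans (cong (c i +v_) (+v-identityʳ (c j))) (trans (cong (_+v c j) ci≡cj) (+v-same (c j)))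

-- Hyperplanes

dot : ∀ {n} → V n → V n → Bool
dot []      []      = false
dot (a ∷ h) (x ∷ v) = (a ∧ x) xor dot h v

dot-additive : ∀ {n} (h u v : V n) → dot h (u +v v) ≡ dot h u xor dot h v
dot-additive []      []      []      = refl
dot-additive (a ∷ h) (x ∷ u) (y ∷ v) =
  trans (cong₂ _xor_ (∧-distribˡ-xor a x y) (dot-additive h u v)) (xor-interchange (a ∧ x) (a ∧ y) (dot h u) (dot h v))

dot-0v : ∀ {n} (h : V n) → dot h 0v ≡ false
dot-0v []          = refl
dot-0v (true ∷ h)  = dot-0v h
dot-0v (false ∷ h) = dot-0v h

dot-sumOver : ∀ {m n} (h : V n) (J : Fin m → Bool) (f : Fin m → V n) →
  (∀ i → T (J i) → dot h (f i) ≡ false) → dot h (sumOver J f) ≡ false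
dot-sumOver {zero}  h J f orth = dot-0v h
dot-sumOver {suc m} h J f orth =
  trans (dot-additive h _ _) (cong₂ _xor_ (head (J zero) refl) (dot-sumOver h (λ i → J (suc i)) (λ i → f (suc i)) (λ i → orth (suc i))))
  where
  head : ∀ b → J zero ≡ b → dot h (scale b (f zero)) ≡ false
  head true  J0 = orth zero (subst T (sym J0) tt)
  head false _  = dot-0v h

inPlane : ∀ {n} → V n → V n → Bool
inPlane h w = not (isZero w) ∧ not (dot h w)

hyperplane-flat : ∀ {n m} (c : Fin m → V n) (h : V n) → Flat (colMat c) (λ i → not (dot h (c i)))
hyperplane-flat c h e (I , I⊆F , ind , dependent) with dot h (c e) in he
... | false = tt
... | true  = dependent I∪e-independent
  where
  I∪e-independent : Ind (colMat c) (⟦ I ⟧ ∪ ｛ e ｝)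
  I∪e-independent J J⊆ nonempty sum≡0 with J e in Je
  ... | false = ind J (λ x Jx → J⊆I x Jx) nonempty sum≡0
    where
    J⊆I : ⟦ J ⟧ ⊆ ⟦ I ⟧
    J⊆I x Jx with J⊆ x Jx
    ... | inj₁ Ix   = Ix
    ... | inj₂ refl = ⊥-elim (subst T Je Jx)
  ... | true = true≢false (begin
      true                                                 ≡⟨ sym he ⟩
      dot h (c e)                                          ≡⟨ sym (cong (λ b → dot h (scale b (c e))) Je) ⟩
      false xor dot h (scale (J e) (c e))                  ≡⟨ cong (_xor dot h (scale (J e) (c e))) (sym rest-in-plane) ⟩
      dot h (sumOver (J without e) c) xor dot h (scale (J e) (c e)) ≡⟨ sym (dot-additive h _ _) ⟩
      dot h (sumOver (J without e) c +v scale (J e) (c e)) ≡⟨ cong (dot h) (sym (sumOver-remove J e c)) ⟩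
      dot h (sumOver J c)                                  ≡⟨ cong (dot h) sum≡0 ⟩
      dot h 0v                                             ≡⟨ dot-0v h ⟩
      false                                                ∎)
    where
    open ≡-Reasoning
    rest-in-plane : dot h (sumOver (J without e) c) ≡ false
    rest-in-plane = dot-sumOver h (J without e) c in-plane
      where
      in-plane : ∀ i → T ((J without e) i) → dot h (c i) ≡ false
      in-plane i t with i ≟ e
      ... | yes _ = ⊥-elim (T-∧ʳ {J i} t)
      ... | no i≢e with J⊆ i (T-∧ˡ t)
      ...   | inj₁ Ii  = Equivalence.to T-not-≡ (I⊆F i Ii)
      ...   | inj₂ i≡e = ⊥-elim (i≢e i≡e)

flat-span-closed : ∀ {k n m} {c : Fin m → V n} {F : Fin m → Bool} → Flat (colMat c) F →
  (f : Fin k → Fin m) → Injective _≡_ _≡_ f → (∀ j → T (F (f j))) → Ind (colMat c) (Range f) →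
  ∀ i s → lin (λ j → c (f j)) s ≡ c i → T (F i)
flat-span-closed {c = c} {F} flat f f-inj f∈F ind i s spanned with T? (F i)
... | yes Fi = Fi
... | no ¬Fi = flat i (image _≟_ f , image⊆F , colMat-hereditary c image⊆Range ind , dependent)
  where
  image⊆Range : ⟦ image _≟_ f ⟧ ⊆ Range f
  image⊆Range x t = image-sound _≟_ f t
  image⊆F : ⟦ image _≟_ f ⟧ ⊆ ⟦ F ⟧
  image⊆F x t = let (j , fj≡x) = image-sound _≟_ f t in subst (λ y → T (F y)) fj≡x (f∈F j)
  dependent : ¬ Ind (colMat c) (⟦ image _≟_ f ⟧ ∪ ｛ i ｝)
  dependent ind′ = Ind⇒sum≢0 {g = i ∷ᶠ f}
    (∷ᶠ-injective (λ j i≡fj → ¬Fi (subst (λ y → T (F y)) (sym i≡fj) (f∈F j))) f-inj) ind′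
    (true ∷ᶠ lookup s) (λ { zero _ → inj₂ refl ; (suc j) _ → inj₁ (image-complete _≟_ f j) }) (zero , tt)
    (trans (cong (c i +v_) spanned) (+v-same (c i)))

linear-≅ : ∀ {k m n p} {c : Fin m → V n} {F : Fin m → Bool} {B : Fin k → V p} (L : Fin p → V n) →
  TrivialKernel L → (φ : Σ (Fin m) (λ i → T (F i)) ↔ Fin k) →
  (∀ j → c (proj₁ (Inverse.from φ j)) ≡ lin L (B j)) → (colMat c ∣ F) ≅ colMat B
linear-≅ {k} {m} {c = c} {F} {B} L kernel φ images = φ , λ I → mk⇔ (forward I) (backward I)
  where
  g : Fin k → Fin m
  g j = proj₁ (Inverse.from φ j)
  g-injective : Injective _≡_ _≡_ g
  g-injective e = Injection.injective (↔⇒↣ (↔-sym φ)) (proj₁-injective e)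
  sum-via-L : ∀ s → sumOver s (λ j → c (g j)) ≡ lin L (sumOver s B)
  sum-via-L s = trans (sumOver-cong (λ _ → refl) images) (sumOver-linear (lin-additive L) s B)
  forward : ∀ I → Ind (colMat c ∣ F) I → Ind (colMat B) (λ j → I (Inverse.from φ j))
  forward I ind J J⊆I nonempty sum≡0 =
    Ind⇒sum≢0 g-injective ind J (λ j Jj → proj₂ (Inverse.from φ j) , J⊆I j Jj) nonempty
      (trans (sum-via-L J) (trans (cong (lin L) sum≡0) (additive⇒0↦0 (lin-additive L))))
  backward : ∀ I → Ind (colMat B) (λ j → I (Inverse.from φ j)) → Ind (colMat c ∣ F) I
  backward I indB J J⊆I (x , Jx) sum≡0 =
    indB (λ j → J (g j)) pulled (Inverse.to φ (x , Fx) , subst (λ y → T (J y)) (sym (cong proj₁ (back (x , Fx)))) Jx)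
      (kernel _ (trans (sym (sum-via-L _)) (trans (sym (sumOver-reindex g g-injective J support c)) sum≡0)))
    where
    back : ∀ y → Inverse.from φ (Inverse.to φ y) ≡ y
    back = Inverse.strictlyInverseʳ φ
    Fx : T (F x)
    Fx = proj₁ (J⊆I x Jx)
    support : ∀ y → T (J y) → ∃ λ j → g j ≡ y
    support y Jy = Inverse.to φ (y , proj₁ (J⊆I y Jy)) , cong proj₁ (back (y , proj₁ (J⊆I y Jy)))
    pulled : ⟦ (λ j → J (g j)) ⟧ ⊆ (λ j → I (Inverse.from φ j))
    pulled j Jgj = subst I (proj₁-injective refl) (proj₂ (J⊆I (g j) Jgj))

-- Point sets of PG(3,2)

Table : ℕ → Set
Table zero    = Bool
Table (suc n) = Table n × Table n

member : ∀ {n} → Table n → V n → Bool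
member b       []          = b
member (t , _) (true ∷ v)  = member t v
member (_ , f) (false ∷ v) = member f v

tabulateᵗ : ∀ n → (V n → Bool) → Table n
tabulateᵗ zero    P = P []
tabulateᵗ (suc n) P = tabulateᵗ n (λ v → P (true ∷ v)) , tabulateᵗ n (λ v → P (false ∷ v))

member-tabulateᵗ : ∀ n (P : V n → Bool) v → member (tabulateᵗ n P) v ≡ P v
member-tabulateᵗ zero    P []          = refl
member-tabulateᵗ (suc n) P (true ∷ v)  = member-tabulateᵗ n (λ v → P (true ∷ v)) v
member-tabulateᵗ (suc n) P (false ∷ v) = member-tabulateᵗ n (λ v → P (false ∷ v)) v

allTables : ∀ n → (Table n → Bool) → Bool
allTables zero    P = P true ∧ P false
allTables (suc n) P = allTables n (λ t → allTables n (λ f → P (t , f)))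

allTablesWithout0v : ∀ n → (Table n → Bool) → Bool
allTablesWithout0v zero    P = P false
allTablesWithout0v (suc n) P = allTables n (λ t → allTablesWithout0v n (λ f → P (t , f)))

allTables-≡-sound : ∀ n {P : Table n → Bool} → allTables n P ≡ true → ∀ t → P t ≡ true
allTables-≡-sound zero        all true    = proj₁ (∧≡true all)
allTables-≡-sound zero    {P} all false   = proj₂ (∧≡true {P true} all)
allTables-≡-sound (suc n)     all (t , f) = allTables-≡-sound n (allTables-≡-sound n all t) f

allTablesWithout0v-≡-sound : ∀ n {P : Table n → Bool} → allTablesWithout0v n P ≡ true → ∀ t → ¬ T (member t 0v) → P t ≡ true
allTablesWithout0v-≡-sound zero    all true    0∉t = ⊥-elim (0∉t tt)
allTablesWithout0v-≡-sound zero    all false   _   = all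
allTablesWithout0v-≡-sound (suc n) all (t , f) 0∉t = allTablesWithout0v-≡-sound n (allTables-≡-sound n all t) f 0∉t

planeSize : Table 4 → V 4 → ℕ
planeSize t h = countV 4 (λ w → inPlane h w ∧ member t w)

pivot : ∀ {n} → V (suc n) → Fin (suc n)
pivot {zero}  _           = zero
pivot {suc n} (true ∷ _)  = zero
pivot {suc n} (false ∷ v) = suc (pivot v)

-- A line {w, w+q} through q is represented by its point with a zero at the pivot coordinate of q.
classRepresentative : Table 4 → V 4 → V 4 → Bool
classRepresentative t q w =
  not (isZero w) ∧ (member t w ∨ member t (w +v q)) ∧ not (lookup w (pivot q))

classCount : Table 4 → V 4 → ℕ
classCount t p = countV 4 (classRepresentative t p)

noSixPlaneOrSixClasses : Table 4 → Bool
noSixPlaneOrSixClasses t =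
  allV 4 (λ h → isZero h ∨ not (planeSize t h ≡ᵇ 6)) ∧
  allV 4 (λ p → not (member t p) ∨ not (classCount t p ≡ᵇ 6))

realises : ∀ {k} → Table 4 → V 4 → (Fin 4 → V 4) → (Fin k → V 4) → Bool
realises t h L B =
  allFin (λ j → member t (lin L (B j)) ∧ not (dot h (lin L (B j)))) ∧
  (trivialKernelᵇ L ∧
   allV 4 (λ w → not (inPlane h w ∧ member t w) ∨ anyFin (λ j → w == lin L (B j))))

columns4 : V 4 → V 4 → V 4 → V 4 → Fin 4 → V 4
columns4 a b c d zero                   = a
columns4 a b c d (suc zero)             = b
columns4 a b c d (suc (suc zero))       = c
columns4 a b c d (suc (suc (suc zero))) = d

-- Vertex i of K4 goes to column i, so edge ij goes to a sum of two columns; the six sums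
-- a, b, a+b, q+a, q+b, q+a+b are the points of the plane h other than the missing point q.
K4-map : Table 4 → V 4 → Fin 4 → V 4
K4-map t h = choose-q (findV 4 (λ w → inPlane h w ∧ not (member t w))) (findV 4 (dot h))
  where
  choose-b : V 4 → V 4 → V 4 → V 4 → Fin 4 → V 4
  choose-b q y a b = columns4 y (y +v a) (y +v b) (((q +v a) +v b) +v y)
  choose-a : V 4 → V 4 → V 4 → Fin 4 → V 4
  choose-a q y a = choose-b q y a (findV 4 (λ w → inPlane h w ∧ not (w == q) ∧ not (w == a) ∧ not (w == (a +v q))))
  choose-q : V 4 → V 4 → Fin 4 → V 4
  choose-q q y = choose-a q y (findV 4 (λ w → inPlane h w ∧ not (w == q)))

-- The edges of the 4-cycle go to d, d+a, d+a+b, d+b: the plane h minus the line {a, b, a+b} missing from t.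
C4-map : Table 4 → V 4 → Fin 4 → V 4
C4-map t h = choose-a (findV 4 (dot h)) (findV 4 (λ w → inPlane h w ∧ not (member t w)))
  where
  choose-bd : V 4 → V 4 → V 4 → V 4 → Fin 4 → V 4
  choose-bd y a b d = columns4 y (y +v d) (y +v a) ((y +v d) +v b)
  choose-a : V 4 → V 4 → Fin 4 → V 4
  choose-a y a = choose-bd y a (findV 4 (λ w → inPlane h w ∧ not (member t w) ∧ not (w == a)))
                               (findV 4 (λ w → inPlane h w ∧ member t w))

K4-or-C4-planeOfSize : Table 4 → V 4 → ℕ → Bool
K4-or-C4-planeOfSize t h size =
  ((size ≡ᵇ 6) ∧ realises t h (K4-map t h) incK4) ∨ ((size ≡ᵇ 4) ∧ realises t h (C4-map t h) incC4)

K4-or-C4-plane : Table 4 → V 4 → Bool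
K4-or-C4-plane t h = not (isZero h) ∧ K4-or-C4-planeOfSize t h (planeSize t h)

dichotomyᵇ : Table 4 → Bool
dichotomyᵇ t = (countV 4 (member t) <ᵇ 10) ∨ (anyV 4 (K4-or-C4-plane t) ∨ noSixPlaneOrSixClasses t)

columns3 : V 4 → V 4 → V 4 → Fin 3 → V 4
columns3 a b c zero             = a
columns3 a b c (suc zero)       = b
columns3 a b c (suc (suc zero)) = c

planeNormal : (Fin 3 → V 4) → V 4
planeNormal u = findV 4 (λ h → not (isZero h) ∧ allFin (λ j → not (dot h (u j))))

spansPlaneNormalTo : (Fin 3 → V 4) → V 4 → Bool
spansPlaneNormalTo u h = not (isZero h) ∧ allFin (λ j → not (dot h (u j))) ∧ allV 4 (λ x → dot h x ∨ anyV 3 (λ s → lin u s == x))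

spansPlaneIfIndependent : V 4 → V 4 → V 4 → Bool
spansPlaneIfIndependent a b c =
  not (trivialKernelᵇ (columns3 a b c)) ∨ spansPlaneNormalTo (columns3 a b c) (planeNormal (columns3 a b c))

-- The closed checks are stated as `≡ true` and proved by refl: checking them as `T b` is far slower.
triples-span-planes : ∀ a b c → T (spansPlaneIfIndependent a b c)
triples-span-planes a b c = Equivalence.from T-≡
  (allV-≡-sound 4 {λ c → spansPlaneIfIndependent a b c}
    (allV-≡-sound 4 {λ b → allV 4 λ c → spansPlaneIfIndependent a b c}
      (allV-≡-sound 4 {λ a → allV 4 λ b → allV 4 λ c → spansPlaneIfIndependent a b c} refl a) b) c)

dichotomy-for-all-tables : ∀ t → ¬ T (member t 0v) → T (dichotomyᵇ t)
dichotomy-for-all-tables t 0∉t = Equivalence.from T-≡ (allTablesWithout0v-≡-sound 4 {dichotomyᵇ} refl t 0∉t)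

plane-spanned : ∀ (u : Fin 3 → V 4) → Independent u →
  ∃ λ h → h ≢ 0v × (∀ j → dot h (u j) ≡ false) × (∀ x → dot h x ≡ false → ∃ λ s → lin u s ≡ x)
plane-spanned u indep =
  h , (λ h≡0 → T-not-elim (T-∧ˡ spans) (==-complete h≡0)) , orthogonal , spanning
  where
  u₃ : Fin 3 → V 4
  u₃ = columns3 (u zero) (u (suc zero)) (u (suc (suc zero)))
  u₃≗u : ∀ j → u₃ j ≡ u j
  u₃≗u zero             = refl
  u₃≗u (suc zero)       = refl
  u₃≗u (suc (suc zero)) = refl
  lin-u₃ : ∀ s → lin u₃ s ≡ lin u s
  lin-u₃ s = sumOver-cong {J = lookup s} (λ _ → refl) u₃≗u
  h : V 4
  h = planeNormal u₃
  check : T (spansPlaneIfIndependent (u zero) (u (suc zero)) (u (suc (suc zero))))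
  check = triples-span-planes (u zero) (u (suc zero)) (u (suc (suc zero)))
  spans : T (spansPlaneNormalTo u₃ h)
  spans with T-∨-split check
  ... | inj₂ s         = s
  ... | inj₁ dependent = ⊥-elim (T-not-elim dependent (trivialKernelᵇ-complete u₃
                           (λ w e → independent⇒trivialKernel {u = u} indep w (trans (sym (lin-u₃ w)) e))))
  orthogonal : ∀ j → dot h (u j) ≡ false
  orthogonal j = subst (λ v → dot h v ≡ false) (u₃≗u j)
    (Equivalence.to T-not-≡ (allFin-sound {P = λ j → not (dot h (u₃ j))} (T-∧ˡ (T-∧ʳ {not (isZero h)} spans)) j))
  spanning : ∀ x → dot h x ≡ false → ∃ λ s → lin u s ≡ x
  spanning x x⊥h with T-∨-split (allV-sound 4 {λ x → dot h x ∨ anyV 3 (λ s → lin u₃ s == x)}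
                                   (T-∧ʳ {allFin (λ j → not (dot h (u₃ j)))} (T-∧ʳ {not (isZero h)} spans)) x)
  ... | inj₁ x·h = ⊥-elim (subst T x⊥h x·h)
  ... | inj₂ found = let (s , e) = anyV-sound 3 {λ s → lin u₃ s == x} found in s , trans (sym (lin-u₃ s)) (==-sound e)

-- Lines through a point

SameClass : ∀ {n} → V n → V n → V n → Set
SameClass q u v = u ≡ v ⊎ u ≡ v +v q

SameClass-trans : ∀ {n} {q u v w : V n} → SameClass q u v → SameClass q v w → SameClass q u w
SameClass-trans         (inj₁ refl) v~w         = v~w
SameClass-trans         (inj₂ refl) (inj₁ refl) = inj₂ refl
SameClass-trans {q = q} {w = w} (inj₂ refl) (inj₂ refl) = inj₁ (+v-involutive w q)

canonical : ∀ {n} → Fin n → V n → V n → V n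
canonical j q w = if lookup w j then w +v q else w

canonical-sameClass : ∀ {n} j (q w : V n) → SameClass q (canonical j q w) w
canonical-sameClass j q w with lookup w j
... | true  = inj₂ refl
... | false = inj₁ refl

canonical-at-pivot : ∀ {n} {j} {q : V n} (w : V n) → T (lookup q j) → ¬ T (lookup (canonical j q w) j)
canonical-at-pivot {j = j} {q} w qj with lookup w j in wj
... | false = λ t → subst T wj t
... | true  = λ t → subst T (trans (lookup-zipWith _xor_ j w q) (cong₂ _xor_ wj (Equivalence.to T-≡ qj))) t

canonical-of-representative : ∀ {n} {j} {q v w : V n} → T (lookup q j) → ¬ T (lookup v j) →
  SameClass q w v → canonical j q w ≡ v
canonical-of-representative {j = j} {q} {v} qj ¬vj (inj₁ refl) with lookup v j in vj
... | false = refl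
... | true  = ⊥-elim (¬vj tt)
canonical-of-representative {j = j} {q} {v} qj ¬vj (inj₂ refl) with lookup (v +v q) j in wj
... | true  = +v-involutive v q
... | false = ⊥-elim (¬vj (subst T (sym v-bit) tt))
  where
  v-bit : lookup v j ≡ true
  v-bit = flipped (lookup v j) (trans (cong (lookup v j xor_) (sym (Equivalence.to T-≡ qj)))
                                      (trans (sym (lookup-zipWith _xor_ j v q)) wj))
    where
    flipped : ∀ b → b xor true ≡ false → b ≡ true
    flipped true _ = refl

canonical-related : ∀ {n} j (q a b : V n) → canonical j q a ≡ canonical j q b → SameClass q a b
canonical-related j q a b e with canonical-sameClass j q a | canonical-sameClass j q b
... | inj₁ ca | inj₁ cb = inj₁ (trans (sym ca) (trans e cb))
... | inj₁ ca | inj₂ cb = inj₂ (trans (sym ca) (trans e cb))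
... | inj₂ ca | inj₁ cb = inj₂ (trans (sym (+v-involutive a q)) (cong (_+v q) (trans (sym ca) (trans e cb))))
... | inj₂ ca | inj₂ cb = inj₁ (+v-cancelʳ q (trans (sym ca) (trans e cb)))

pivot-set : ∀ {n} (q : V (suc n)) → q ≢ 0v → T (lookup q (pivot q))
pivot-set {zero}  (true ∷ [])  _   = tt
pivot-set {zero}  (false ∷ []) q≢0 = q≢0 refl
pivot-set {suc n} (true ∷ q)   _   = tt
pivot-set {suc n} (false ∷ q)  q≢0 = pivot-set q (λ q≡0 → q≢0 (cong (false ∷_) q≡0))

-- Rank four

module ColumnTable {m} (c : Fin m → V 4) where

  -- Abstract, so that the type checker never expands the membership tests of the table.
  abstract
    table : Table 4
    table = tabulateᵗ 4 (image _≟ᵛ_ c)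

    table-sound : ∀ {v} → T (member table v) → ∃ λ i → c i ≡ v
    table-sound {v} t = image-sound _≟ᵛ_ c (subst T (member-tabulateᵗ 4 (image _≟ᵛ_ c) v) t)

    table-complete : ∀ i → T (member table (c i))
    table-complete i = subst T (sym (member-tabulateᵗ 4 (image _≟ᵛ_ c) (c i))) (image-complete _≟ᵛ_ c i)

  table-avoids-0v : (∀ i → c i ≢ 0v) → ¬ T (member table 0v)
  table-avoids-0v nonzero t = let (i , ci≡0) = table-sound t in nonzero i ci≡0

  m≤table-size : Injective _≡_ _≡_ c → m ≤ countV 4 (member table)
  m≤table-size c-inj =
    ↣Fin⇒≤ (↔⇒↣ (countV-↔ 4 (member table)) ↣-∘ mk↣ {to = λ i → c i , table-complete i} (λ e → c-inj (cong proj₁ e)))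

  in-plane : ∀ {h} i → c i ≢ 0v → T (not (dot h (c i))) → T (inPlane h (c i) ∧ member table (c i))
  in-plane i ci≢0 ci⊥h = T-∧-intro (T-∧-intro (T-not-intro (λ z → ci≢0 (==-sound z))) ci⊥h) (table-complete i)

  realises⇒≅ : Injective _≡_ _≡_ c → (∀ i → c i ≢ 0v) →
    ∀ {k} h (L : Fin 4 → V 4) (B : Fin k → V 4) → Injective _≡_ _≡_ B →
    T (realises table h L B) → (colMat c ∣ (λ i → not (dot h (c i)))) ≅ colMat B
  realises⇒≅ c-inj nonzero {k} h L B B-inj check = linear-≅ L kernel φ (λ j → proj₂ (image-point j))
    where
    F : Fin m → Bool
    F i = not (dot h (c i))
    images : T (allFin (λ j → member table (lin L (B j)) ∧ not (dot h (lin L (B j)))))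
    images = T-∧ˡ check
    rest : T (trivialKernelᵇ L ∧ allV 4 (λ w → not (inPlane h w ∧ member table w) ∨ anyFin (λ j → w == lin L (B j))))
    rest = T-∧ʳ {allFin (λ j → member table (lin L (B j)) ∧ not (dot h (lin L (B j))))} check
    kernel : TrivialKernel L
    kernel = trivialKernelᵇ-sound L (T-∧ˡ rest)
    covered : T (allV 4 (λ w → not (inPlane h w ∧ member table w) ∨ anyFin (λ j → w == lin L (B j))))
    covered = T-∧ʳ {trivialKernelᵇ L} rest
    image-point : ∀ j → ∃ λ i → c i ≡ lin L (B j)
    image-point j = table-sound (T-∧ˡ (allFin-sound images j))
    image-in-F : ∀ j → T (F (proj₁ (image-point j)))
    image-in-F j = subst (λ v → T (not (dot h v))) (sym (proj₂ (image-point j)))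
                         (T-∧ʳ {member table (lin L (B j))} (allFin-sound images j))
    preimage : ∀ i → T (F i) → ∃ λ j → c i ≡ lin L (B j)
    preimage i Fi with T-∨-split (allV-sound 4 {λ w → not (inPlane h w ∧ member table w) ∨ anyFin (λ j → w == lin L (B j))}
                                               covered (c i))
    ... | inj₁ outside = ⊥-elim (T-not-elim outside (in-plane {h} i (nonzero i) Fi))
    ... | inj₂ found   = let (j , e) = anyFin-sound {P = λ j → c i == lin L (B j)} found in j , ==-sound {u = c i} e
    L-injective : Injective _≡_ _≡_ (lin L)
    L-injective = trivialKernel⇒injective {u = L} kernel
    φ : Σ (Fin m) (λ i → T (F i)) ↔ Fin k
    φ = mk↔ₛ′ (λ (i , Fi) → proj₁ (preimage i Fi)) (λ j → proj₁ (image-point j) , image-in-F j)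
      (λ j → B-inj (L-injective (trans (sym (proj₂ (preimage _ (image-in-F j)))) (proj₂ (image-point j)))))
      (λ (i , Fi) → proj₁-injective (c-inj (trans (proj₂ (image-point _)) (sym (proj₂ (preimage i Fi))))))

  K4-or-C4-plane-sound : Injective _≡_ _≡_ c → (∀ i → c i ≢ 0v) → ∀ h → T (K4-or-C4-plane table h) →
    Σ[ F ∈ (Fin m → Bool) ] Flat (colMat c) F × ((colMat c ∣ F) ≅ MC4 ⊎ (colMat c ∣ F) ≅ MK4)
  K4-or-C4-plane-sound c-inj nonzero h found with T-∨-split (T-∧ʳ {not (isZero h)} found)
  ... | inj₁ K4 = _ , hyperplane-flat c h ,
                  inj₂ (realises⇒≅ c-inj nonzero h (K4-map table h) incK4 (injectiveᵇ-sound incK4 tt) (T-∧ʳ {planeSize table h ≡ᵇ 6} K4))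
  ... | inj₂ C4 = _ , hyperplane-flat c h ,
                  inj₁ (realises⇒≅ c-inj nonzero h (C4-map table h) incC4 (injectiveᵇ-sound incC4 tt) (T-∧ʳ {planeSize table h ≡ᵇ 4} C4))

module RankFour {m} (c : Fin m → V 4) (simple : Simple (colMat c)) (rank≤4 : Rank≤ 4 (colMat c))
  (no-six-planes : ∀ h → h ≢ 0v → planeSize (ColumnTable.table c) h ≢ 6)
  (no-six-classes : ∀ p → T (member (ColumnTable.table c) p) → classCount (ColumnTable.table c) p ≢ 6) where

  open ColumnTable c

  c-injective : Injective _≡_ _≡_ c
  c-injective = simple⇒injective simple

  c-nonzero : ∀ i → c i ≢ 0v
  c-nonzero = simple⇒nonzero simple

  rank3-flat-is-plane : ∀ {F} → Flat (colMat c) F → IndependentIn (colMat c) F 3 → ¬ IndependentIn (colMat c) F 4 →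
    ∃ λ h → h ≢ 0v × (∀ i → T (F i) → dot h (c i) ≡ false) × (∀ i → dot h (c i) ≡ false → T (F i))
  rank3-flat-is-plane {F} flat (f , f-inj , f∈F , ind) ¬four = h , h≢0 , F⇒⊥h , ⊥h⇒F
    where
    indep : Independent (λ j → c (f j))
    indep = Ind⇒independent f-inj (λ j → j , refl) ind
    plane : ∃ λ h → h ≢ 0v × (∀ j → dot h (c (f j)) ≡ false) × (∀ x → dot h x ≡ false → ∃ λ s → lin (λ j → c (f j)) s ≡ x)
    plane = plane-spanned (λ j → c (f j)) indep
    h : V 4
    h = proj₁ plane
    h≢0 : h ≢ 0v
    h≢0 = proj₁ (proj₂ plane)
    orthogonal : ∀ j → dot h (c (f j)) ≡ false
    orthogonal = proj₁ (proj₂ (proj₂ plane))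
    F⇒⊥h : ∀ i → T (F i) → dot h (c i) ≡ false
    F⇒⊥h i Fi with dot h (c i) in ci·h
    ... | false = refl
    ... | true  = ⊥-elim (¬four (i ∷ᶠ f , enlarged-injective , (λ { zero → Fi ; (suc j) → f∈F j }) ,
                                 colMat-hereditary c Range⊆image (independent⇒Ind-image enlarged-injective enlarged-independent)))
      where
      enlarged-injective : Injective _≡_ _≡_ (i ∷ᶠ f)
      enlarged-injective = ∷ᶠ-injective (λ j i≡fj → true≢false (trans (sym ci·h) (trans (cong (λ x → dot h (c x)) i≡fj) (orthogonal j)))) f-inj
      enlarged-independent : Independent (λ j → c ((i ∷ᶠ f) j))
      enlarged-independent = independent-∷ {u = λ j → c (f j)} indep λ w lin≡ci →
        true≢false (trans (sym ci·h) (trans (cong (dot h) (sym lin≡ci)) (dot-sumOver h (lookup w) (λ j → c (f j)) (λ j _ → orthogonal j))))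
      Range⊆image : Range (i ∷ᶠ f) ⊆ ⟦ image _≟_ (i ∷ᶠ f) ⟧
      Range⊆image x (j , refl) = image-complete _≟_ (i ∷ᶠ f) j
    ⊥h⇒F : ∀ i → dot h (c i) ≡ false → T (F i)
    ⊥h⇒F i ci⊥h = let (s , lin≡ci) = proj₂ (proj₂ (proj₂ plane)) (c i) ci⊥h in flat-span-closed flat f f-inj f∈F ind i s lin≡ci

  rank3-flat : ∀ {F} → Flat (colMat c) F → IndependentIn (colMat c) F 3 → ¬ IndependentIn (colMat c) F 4 →
    SimpleRank≤3Not6 (colMat c ∣ F)
  rank3-flat {F} flat three ¬four = record
    { hereditary = ∣-hereditary {colMat c} (colMat-hereditary c)
    ; simple     = ∣-simple {colMat c} (colMat-hereditary c) simple
    ; rank≤3     = ¬IndependentIn⇒rank≤ {M = colMat c} (colMat-hereditary c) ¬four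
    ; not6       = ↔Fin⇒¬↔Fin F↣plane plane↣F (countV-↔ 4 (λ w → inPlane h w ∧ member table w)) (no-six-planes h h≢0)
    ; _≟ₘ_       = Σ-≟ _≟_
    }
    where
    plane : ∃ λ h → h ≢ 0v × (∀ i → T (F i) → dot h (c i) ≡ false) × (∀ i → dot h (c i) ≡ false → T (F i))
    plane = rank3-flat-is-plane flat three ¬four
    h : V 4
    h = proj₁ plane
    h≢0 : h ≢ 0v
    h≢0 = proj₁ (proj₂ plane)
    PlanePoint : Set
    PlanePoint = Σ (V 4) (λ w → T (inPlane h w ∧ member table w))
    F↣plane : Σ (Fin m) (λ i → T (F i)) ↣ PlanePoint
    F↣plane = mk↣ {to = λ (i , Fi) → c i , in-plane {h} i (c-nonzero i) (Equivalence.from T-not-≡ (proj₁ (proj₂ (proj₂ plane)) i Fi))}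
                  (λ e → proj₁-injective (c-injective (cong proj₁ e)))
    column-of : (x : PlanePoint) → ∃ λ i → c i ≡ proj₁ x
    column-of (w , t) = table-sound (T-∧ʳ {inPlane h w} t)
    orthogonal-column : ∀ x → dot h (c (proj₁ (column-of x))) ≡ false
    orthogonal-column (w , t) = subst (λ v → dot h v ≡ false) (sym (proj₂ (column-of (w , t))))
                                      (Equivalence.to T-not-≡ (T-∧ʳ {not (isZero w)} (T-∧ˡ t)))
    plane↣F : PlanePoint ↣ Σ (Fin m) (λ i → T (F i))
    plane↣F = mk↣ {to = λ x → proj₁ (column-of x) , proj₂ (proj₂ (proj₂ plane)) _ (orthogonal-column x)}
                  (λ {x} {y} e → proj₁-injective (trans (sym (proj₂ (column-of x)))
                                                        (trans (cong (λ i → c (proj₁ i)) e) (proj₂ (column-of y)))))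

  module PointContraction {M} (φ : M ≅ colMat c) {C p₀} (only-p₀ : ∀ x → T (C x) → x ≡ p₀) (Cp₀ : T (C p₀))
    {S} (simplification : IsSimplificationSet (M ／ C) S) where

    private
      ψ : E M ↔ Fin m
      ψ = proj₁ φ
      to : E M → Fin m
      to = Inverse.to ψ
      from : Fin m → E M
      from = Inverse.from ψ
      from∘to : ∀ x → from (to x) ≡ x
      from∘to = Inverse.strictlyInverseʳ ψ
      to∘from : ∀ i → to (from i) ≡ i
      to∘from = Inverse.strictlyInverseˡ ψ
      her : Hereditary M
      her = ≅-hereditary {M} φ (colMat-hereditary c)
      simpleM : Simple M
      simpleM = ≅-simple {M} φ (colMat-hereditary c) simple

    κ : E M → V 4
    κ x = c (to x)

    κ-injective : Injective _≡_ _≡_ κ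
    κ-injective e = ↔-injective ψ (c-injective e)

    q : V 4
    q = κ p₀

    q-pivot : T (lookup q (pivot q))
    q-pivot = pivot-set q (c-nonzero (to p₀))

    triple : E M → E M → Fin 3 → Fin m
    triple a b = to a ∷ᶠ to b ∷ᶠ to p₀ ∷ᶠ []ᶠ

    triple-injective : ∀ {a b} → a ≢ b → a ≢ p₀ → b ≢ p₀ → Injective _≡_ _≡_ (triple a b)
    triple-injective a≢b a≢p b≢p =
      ∷ᶠ-injective (λ { zero e → a≢b (↔-injective ψ e) ; (suc zero) e → a≢p (↔-injective ψ e) ; (suc (suc ())) })
        (∷ᶠ-injective (λ { zero e → b≢p (↔-injective ψ e) ; (suc ()) }) (∷ᶠ-injective (λ ()) (λ { {()} })))

    independent-pair : ∀ a b → a ≢ b → a ≢ p₀ → b ≢ p₀ → Ind M (pair a b ∪ ｛ p₀ ｝) → κ a +v κ b ≢ q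
    independent-pair a b a≢b a≢p b≢p ind sum≡q =
      Ind⇒independent (triple-injective a≢b a≢p b≢p) members (Equivalence.to (proj₂ φ _) ind)
        (λ _ → true) (zero , tt) sum≡0
      where
      members : ∀ j → (pair a b ∪ ｛ p₀ ｝) (from (triple a b j))
      members zero             = inj₁ (inj₁ (from∘to a))
      members (suc zero)       = inj₁ (inj₂ (from∘to b))
      members (suc (suc zero)) = inj₂ (from∘to p₀)
      sum≡0 : κ a +v (κ b +v (q +v 0v)) ≡ 0v
      sum≡0 = trans (cong (λ z → κ a +v (κ b +v z)) (+v-identityʳ q))
                (trans (sym (+v-assoc (κ a) (κ b) q)) (trans (cong (_+v q) sum≡q) (+v-same q)))

    dependent-pair : ∀ a b → a ≢ p₀ → b ≢ p₀ → ¬ Ind M (pair a b ∪ ｛ p₀ ｝) → SameClass q (κ b) (κ a)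
    dependent-pair a b a≢p b≢p dependent with κ b ≟ᵛ κ a | κ b ≟ᵛ κ a +v q
    ... | yes e  | _      = inj₁ e
    ... | no _   | yes e  = inj₂ e
    ... | no ne₁ | no ne₂ = ⊥-elim (dependent (Equivalence.from (proj₂ φ _)
          (colMat-hereditary c image-covers (independent⇒Ind-image injective indep))))
      where
      injective : Injective _≡_ _≡_ (triple a b)
      injective = triple-injective (λ a≡b → ne₁ (cong κ (sym a≡b))) a≢p b≢p
      indep : Independent (λ j → c (triple a b j))
      indep = independent₃ (c-nonzero _) (c-nonzero _) (c-nonzero _) (λ e → ne₁ (sym e))
                (λ e → a≢p (κ-injective e)) (λ e → b≢p (κ-injective e))
                (λ e → ne₂ (trans (sym (+v-involutive (κ b) q)) (cong (_+v q) (sym e))))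
      hit : ∀ {i} j → from i ≡ from (triple a b j) → T (image _≟_ (triple a b) i)
      hit {i} j e = subst (λ y → T (image _≟_ (triple a b) y))
                          (trans (sym (to∘from (triple a b j))) (trans (cong to (sym e)) (to∘from i)))
                          (image-complete _≟_ (triple a b) j)
      image-covers : (λ i → (pair a b ∪ ｛ p₀ ｝) (from i)) ⊆ ⟦ image _≟_ (triple a b) ⟧
      image-covers i (inj₁ (inj₁ e)) = hit zero             (trans e (sym (from∘to a)))
      image-covers i (inj₁ (inj₂ e)) = hit (suc zero)       (trans e (sym (from∘to b)))
      image-covers i (inj₂ e)        = hit (suc (suc zero)) (trans e (sym (from∘to p₀)))

    Class : Set
    Class = Σ (V 4) (λ w → T (classRepresentative table q w))

    x≢p₀ : ∀ (x : E (M ／ C)) → proj₁ x ≢ p₀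
    x≢p₀ x x≡p₀ = contracted≢ x Cp₀ (sym x≡p₀)

    class-of : E (M ／ C) → Class
    class-of x = canonical (pivot q) q w ,
                 T-∧-intro nonzero (T-∧-intro present (T-not-intro (canonical-at-pivot w q-pivot)))
      where
      w : V 4
      w = κ (proj₁ x)
      nonzero : T (not (isZero (canonical (pivot q) q w)))
      nonzero with canonical-sameClass (pivot q) q w
      ... | inj₁ e = T-not-intro λ z → c-nonzero _ (trans (sym e) (==-sound z))
      ... | inj₂ e = T-not-intro λ z → x≢p₀ x (κ-injective (+v≡0⇒≡ (trans (sym e) (==-sound z))))
      present : T (member table (canonical (pivot q) q w) ∨ member table (canonical (pivot q) q w +v q))
      present with canonical-sameClass (pivot q) q w
      ... | inj₁ e = T-∨-introˡ (subst (λ v → T (member table v)) (sym e) (table-complete _))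
      ... | inj₂ e = T-∨-introʳ {member table (canonical (pivot q) q w)}
                       (subst (λ v → T (member table v)) (sym (trans (cong (_+v q) e) (+v-involutive w q))) (table-complete _))

    contraction-Ind⇔ : ∀ I → Ind (M ／ C) I ⇔ Ind M (lift (λ e → not (C e)) I ∪ ｛ p₀ ｝)
    contraction-Ind⇔ = ／-point {M} her simpleM only-p₀ Cp₀

    pair-independent : ∀ (x y : E (M ／ C)) → Ind (M ／ C) (pair x y) → Ind M (pair (proj₁ x) (proj₁ y) ∪ ｛ p₀ ｝)
    pair-independent x y ind = her lifted (Equivalence.to (contraction-Ind⇔ (pair x y)) ind)
      where
      lifted : (pair (proj₁ x) (proj₁ y) ∪ ｛ p₀ ｝) ⊆ (lift (λ e → not (C e)) (pair x y) ∪ ｛ p₀ ｝)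
      lifted _ (inj₁ (inj₁ refl)) = inj₁ (proj₂ x , inj₁ refl)
      lifted _ (inj₁ (inj₂ refl)) = inj₁ (proj₂ y , inj₂ refl)
      lifted _ (inj₂ refl)        = inj₂ refl

    pair-dependent : ∀ (x y : E (M ／ C)) → ¬ Ind (M ／ C) (pair x y) → ¬ Ind M (pair (proj₁ x) (proj₁ y) ∪ ｛ p₀ ｝)
    pair-dependent x y dep ind = dep (Equivalence.from (contraction-Ind⇔ (pair x y)) (her lowered ind))
      where
      lowered : (lift (λ e → not (C e)) (pair x y) ∪ ｛ p₀ ｝) ⊆ (pair (proj₁ x) (proj₁ y) ∪ ｛ p₀ ｝)
      lowered z (inj₁ q)    = inj₁ (pair-lift x y z q)
      lowered z (inj₂ z≡p₀) = inj₂ z≡p₀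

    _≟M_ : DecidableEquality (E M)
    _≟M_ = ≅-≟ {M} {colMat c} φ _≟_

    Contracted : Set
    Contracted = E ((M ／ C) ∣ S)

    to-class : Contracted → Class
    to-class x = class-of (proj₁ x)

    to-class-injective : Injective _≡_ _≡_ to-class
    to-class-injective {x} {y} e =
      same-element (canonical-related (pivot q) q _ _ (cong proj₁ e)) (proj₁ (proj₁ x) ≟M proj₁ (proj₁ y))
      where
      pair-in-contraction : Ind (M ／ C) (pair (proj₁ x) (proj₁ y))
      pair-in-contraction = ／-hereditary {M} her (λ { _ (inj₁ refl) → proj₂ x , inj₁ refl ; _ (inj₂ refl) → proj₂ y , inj₂ refl })
        (simplification-simple {M ／ C} (／-hereditary {M} her) simplification x y)
      same-element : SameClass q (κ (proj₁ (proj₁ x))) (κ (proj₁ (proj₁ y))) → Dec (proj₁ (proj₁ x) ≡ proj₁ (proj₁ y)) → x ≡ y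
      same-element _            (yes x≡y)  = proj₁-injective (proj₁-injective x≡y)
      same-element (inj₁ κx≡κy) (no _)     = proj₁-injective (proj₁-injective (κ-injective κx≡κy))
      same-element (inj₂ κx≡κy+q) (no x≢y) = ⊥-elim (independent-pair _ _ x≢y (x≢p₀ (proj₁ x)) (x≢p₀ (proj₁ y))
                                                (pair-independent (proj₁ x) (proj₁ y) pair-in-contraction) (+v-swap κx≡κy+q))

    nearby-representative : ∀ (x : E (M ／ C)) → Σ (E (M ／ C)) λ f → T (S f) × SameClass q (κ (proj₁ f)) (κ (proj₁ x))
    nearby-representative x = f , Sf , near (proj₂ (proj₂ chosen))
      where
      x-independent : Ind (M ／ C) ｛ x ｝
      x-independent = Equivalence.from (contraction-Ind⇔ ｛ x ｝)
        (her (λ { z (inj₁ (_ , z≡x)) → inj₁ (cong proj₁ z≡x) ; z (inj₂ z≡p₀) → inj₂ z≡p₀ }) (simpleM (proj₁ x) p₀))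
      chosen : Σ (E (M ／ C)) λ f → T (S f) × (f ≡ x ⊎ ¬ Ind (M ／ C) (pair x f))
      chosen = proj₂ simplification x x-independent
      f : E (M ／ C)
      f = proj₁ chosen
      Sf : T (S f)
      Sf = proj₁ (proj₂ chosen)
      near : f ≡ x ⊎ ¬ Ind (M ／ C) (pair x f) → SameClass q (κ (proj₁ f)) (κ (proj₁ x))
      near (inj₁ f≡x) = inj₁ (cong (λ y → κ (proj₁ y)) f≡x)
      near (inj₂ dep) = dependent-pair (proj₁ x) (proj₁ f) (x≢p₀ x) (x≢p₀ f) (pair-dependent x f dep)

    class-element : ∀ v → T (classRepresentative table q v) → Σ (E (M ／ C)) λ x → SameClass q (κ (proj₁ x)) v
    class-element v rep = (e , T-not-intro (λ Ce → e≢p₀ (only-p₀ e Ce))) , subst (λ w → SameClass q w v) (sym κe≡ci) ci~v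
      where
      v≢0 : v ≢ 0v
      v≢0 v≡0 = T-not-elim (T-∧ˡ rep) (==-complete v≡0)
      v-off-pivot : ¬ T (lookup v (pivot q))
      v-off-pivot = T-not-elim (T-∧ʳ {member table v ∨ member table (v +v q)} (T-∧ʳ {not (isZero v)} rep))
      column : ∃ λ i → SameClass q (c i) v
      column with T-∨-split (T-∧ˡ (T-∧ʳ {not (isZero v)} rep))
      ... | inj₁ t = let (i , ci≡v) = table-sound t in i , inj₁ ci≡v
      ... | inj₂ t = let (i , ci≡v+q) = table-sound t in i , inj₂ ci≡v+q
      i : Fin m
      i = proj₁ column
      ci~v : SameClass q (c i) v
      ci~v = proj₂ column
      e : E M
      e = from i
      κe≡ci : κ e ≡ c i
      κe≡ci = cong c (to∘from i)
      e≢p₀ : e ≢ p₀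
      e≢p₀ e≡p₀ = q-off-class (subst (λ w → SameClass q w v) (trans (sym κe≡ci) (cong κ e≡p₀)) ci~v)
        where
        q-off-class : ¬ SameClass q q v
        q-off-class (inj₁ q≡v)   = v-off-pivot (subst (λ w → T (lookup w (pivot q))) q≡v q-pivot)
        q-off-class (inj₂ q≡v+q) = v≢0 (+v-cancelʳ q (trans (sym q≡v+q) (sym (+v-identityˡ q))))

    representative : ∀ v → T (classRepresentative table q v) → Σ (E (M ／ C)) λ f → T (S f) × SameClass q (κ (proj₁ f)) v
    representative v rep =
      let (x , x~v) = class-element v rep
          (f , Sf , f~x) = nearby-representative x
      in f , Sf , SameClass-trans f~x x~v

    from-class : Class → Contracted
    from-class (v , rep) = let (f , Sf , _) = representative v rep in f , Sf

    to-class∘from-class : ∀ w → to-class (from-class w) ≡ w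
    to-class∘from-class (v , rep) = proj₁-injective
      (canonical-of-representative q-pivot
        (T-not-elim (T-∧ʳ {member table v ∨ member table (v +v q)} (T-∧ʳ {not (isZero v)} rep)))
        (proj₂ (proj₂ (representative v rep))))

    not6 : ¬ (Fin 6 ↔ Contracted)
    not6 = ↔Fin⇒¬↔Fin (mk↣ to-class-injective)
      (mk↣ {to = from-class} λ {u} {w} e →
        trans (sym (to-class∘from-class u)) (trans (cong to-class e) (to-class∘from-class w)))
      (countV-↔ 4 (classRepresentative table q)) (no-six-classes q (table-complete (to p₀)))

    contraction-invariant : SimpleRank≤3Not6 ((M ／ C) ∣ S)
    contraction-invariant = record
      { hereditary = ∣-hereditary {M ／ C} (／-hereditary {M} her)
      ; simple     = simplification-simple {M ／ C} (／-hereditary {M} her) simplification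
      ; rank≤3     = ∣-rank≤ {M = M ／ C} {S} (／-rank≤-drop {M = M} her simpleM Cp₀ (≅-rank≤ {M = colMat c} φ rank≤4))
      ; not6       = not6
      ; _≟ₘ_       = Σ-≟ (Σ-≟ _≟M_)
      }

  ¬K4≼-rank4 : 9 < m → ∀ {M} → M ≅ colMat c → ¬ (MK4 ≼ M)
  ¬K4≼-rank4 9<m φ (done (ψ , _)) = <⇒≱ 9<m (≤-trans (↣Fin⇒≤ (↔⇒↣ (↔-sym (proj₁ φ ↔-∘ ψ)))) (m≤m+n 6 3))
  ¬K4≼-rank4 9<m {M} φ (restr F flat d) = ¬¬-excluded-middle λ
    { (yes four) → ¬K4≼-rank4 9<m (≅-trans {M ∣ F} {M} {colMat c} (∣-full≅ {M} her (full four)) φ) d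
    ; (no ¬four) → ¬¬-excluded-middle λ
        { (yes three) → ¬K4≼-rank≤3 (≅-SimpleRank≤3Not6 θ (rank3-flat flat′ three ¬four)) d
        ; (no ¬three) → ¬K4≼-rank≤2 (≅-rank≤ {N = M ∣ F} θ (¬IndependentIn⇒rank≤ {M = colMat c} (colMat-hereditary c) ¬three)) d
        }
    }
    where
    her : Hereditary M
    her = ≅-hereditary {M} φ (colMat-hereditary c)
    F′ : Fin m → Bool
    F′ i = F (Inverse.from (proj₁ φ) i)
    θ : (M ∣ F) ≅ (colMat c ∣ F′)
    θ = ∣-≅ {M} {colMat c} φ
    flat′ : Flat (colMat c) F′
    flat′ = ≅-flat {M} {colMat c} (colMat-hereditary c) φ flat
    full : IndependentIn (colMat c) F′ 4 → ∀ x → T (F x)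
    full four x = subst (λ y → T (F y)) (Inverse.strictlyInverseʳ (proj₁ φ) x)
                        (flat-full {M = colMat c} (colMat-hereditary c) _≟_ rank≤4 flat′ four (Inverse.to (proj₁ φ) x))
  ¬K4≼-rank4 9<m {M} φ (contr C S simplification d) = ¬¬-excluded-middle {A = ∃ λ x → T (C x)} λ
    { (no C-empty) → ¬K4≼-rank4 9<m
        (≅-trans {(M ／ C) ∣ S} {M} {colMat c} (／∅∣≅ {M} her simpleM (λ x Cx → C-empty (x , Cx)) simplification) φ) d
    ; (yes (p₀ , Cp₀)) → ¬¬-excluded-middle {A = ∃ λ y → T (C y) × y ≢ p₀} λ
        { (yes (y , Cy , y≢p₀)) → ¬K4≼-rank≤2 (∣-rank≤ {M = M ／ C} {S}
                                     (／-rank≤-drop₂ {M = M} her simpleM _≟M_ Cy Cp₀ y≢p₀ (≅-rank≤ {N = M} φ rank≤4))) d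
        ; (no single) → ¬K4≼-rank≤3 (PointContraction.contraction-invariant φ
                          (λ x Cx → decidable-stable (x ≟M p₀) (λ x≢p₀ → single (x , Cx , x≢p₀))) Cp₀ simplification) d
        }
    }
    where
    her : Hereditary M
    her = ≅-hereditary {M} φ (colMat-hereditary c)
    simpleM : Simple M
    simpleM = ≅-simple {M} φ (colMat-hereditary c) simple
    _≟M_ : DecidableEquality (E M)
    _≟M_ = ≅-≟ {M} {colMat c} φ _≟_

module _ {m} (c : Fin m → V 4) (simple : Simple (colMat c)) (rank≤4 : Rank≤ 4 (colMat c)) (9<m : 9 < m) where

  open ColumnTable c

  private
    c-injective : Injective _≡_ _≡_ c
    c-injective = simple⇒injective simple
    c-nonzero : ∀ i → c i ≢ 0v
    c-nonzero = simple⇒nonzero simple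

  rank4-dichotomy :
    (Σ[ F ∈ (Fin m → Bool) ] Flat (colMat c) F × ((colMat c ∣ F) ≅ MC4 ⊎ (colMat c ∣ F) ≅ MK4))
    ⊎ (∀ {M} → M ≅ colMat c → ¬ (MK4 ≼ M))
  rank4-dichotomy =
    conclude (T-∨-split {countV 4 (member table) <ᵇ 10} (dichotomy-for-all-tables table (table-avoids-0v c-nonzero)))
    where
    negative : T (noSixPlaneOrSixClasses table) → ∀ {M} → M ≅ colMat c → ¬ (MK4 ≼ M)
    negative none = RankFour.¬K4≼-rank4 c simple rank≤4 no-six-planes no-six-classes 9<m
      where
      no-six-planes : ∀ h → h ≢ 0v → planeSize table h ≢ 6
      no-six-planes h h≢0 six = [ (λ h≡0 → h≢0 (==-sound h≡0)) , (λ ≢6 → T-not-elim ≢6 (≡⇒≡ᵇ _ _ six)) ]′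
        (T-∨-split (allV-sound 4 {λ h → isZero h ∨ not (planeSize table h ≡ᵇ 6)} (T-∧ˡ none) h))
      no-six-classes : ∀ p → T (member table p) → classCount table p ≢ 6
      no-six-classes p p∈ six = [ (λ p∉ → T-not-elim p∉ p∈) , (λ ≢6 → T-not-elim ≢6 (≡⇒≡ᵇ _ _ six)) ]′
        (T-∨-split (allV-sound 4 {λ p → not (member table p) ∨ not (classCount table p ≡ᵇ 6)}
                     (T-∧ʳ {allV 4 (λ h → isZero h ∨ not (planeSize table h ≡ᵇ 6))} none) p))
    conclude : T (countV 4 (member table) <ᵇ 10) ⊎ T (anyV 4 (K4-or-C4-plane table) ∨ noSixPlaneOrSixClasses table) →
      (Σ[ F ∈ (Fin m → Bool) ] Flat (colMat c) F × ((colMat c ∣ F) ≅ MC4 ⊎ (colMat c ∣ F) ≅ MK4))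
      ⊎ (∀ {M} → M ≅ colMat c → ¬ (MK4 ≼ M))
    conclude (inj₁ small) = ⊥-elim (<⇒≱ 9<m (≤-pred (≤-trans (s≤s (m≤table-size c-injective)) (<ᵇ⇒< _ 10 small))))
    conclude (inj₂ rest) =
      Data.Sum.map (λ some-plane → let (h , found) = anyV-sound 4 {K4-or-C4-plane table} some-plane in
                                   K4-or-C4-plane-sound c-injective c-nonzero h found)
                   negative (T-∨-split {anyV 4 (K4-or-C4-plane table)} rest)

lemma3p1 : ∀ {n m : ℕ} (A : Fin m → Vec Bool n) →
    Simple (colMat A) → HasRank A 4 → 9 < m →
    (Σ[ F ∈ (Fin m → Bool) ] Flat (colMat A) F ×
    ((colMat A ∣ F) ≅ MC4 ⊎ (colMat A ∣ F) ≅ MK4))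
    ⊎ ¬ (MK4 ≼ colMat A)
lemma3p1 {n} {m} A simple rank 9<m =
  Data.Sum.map transport (λ no-K4 → no-K4 colMat≅) (rank4-dichotomy c simple-c rank≤4 9<m)
  where
  open Coordinates rank
  simple-c : Simple (colMat c)
  simple-c e f = Equivalence.to (proj₂ colMat≅ (pair e f)) (simple e f)
  rank≤4 : Rank≤ 4 (colMat c)
  rank≤4 = ≅-rank≤ {N = colMat c} {M = colMat A} (≅-sym {colMat A} {colMat c} (colMat-hereditary c) colMat≅) (HasRank⇒rank≤ rank)
  transport : Σ[ F ∈ (Fin m → Bool) ] Flat (colMat c) F × ((colMat c ∣ F) ≅ MC4 ⊎ (colMat c ∣ F) ≅ MK4) →
    Σ[ F ∈ (Fin m → Bool) ] Flat (colMat A) F × ((colMat A ∣ F) ≅ MC4 ⊎ (colMat A ∣ F) ≅ MK4)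
  transport (F , flat , iso) = F ,
    ≅-flat {colMat c} {colMat A} {F} (colMat-hereditary A) (≅-sym {colMat A} {colMat c} (colMat-hereditary c) colMat≅) flat ,
    Data.Sum.map (≅-trans {colMat A ∣ F} {colMat c ∣ F} {MC4} (∣-≅ {colMat A} {colMat c} {F} colMat≅))
                 (≅-trans {colMat A ∣ F} {colMat c ∣ F} {MK4} (∣-≅ {colMat A} {colMat c} {F} colMat≅)) iso
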